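{- There is an absolute constant $C$ such that the following holds. Let $n,k,t$ be positive integers with $t\le\min\{k,\sqrt{d}\}$, where $d=(n/k)^{1/3}$. Let $H$ be an $n$-vertex $3$-graph with $e\ge C\frac{n^3}{td^2}$ edges. Let $C_0\subseteq V(H)$ with $|C_0|\le 16nt/d$ and assume every edge of $H$ has precisely one vertex in $C_0$. Then $H$ contains $d$ vertex-disjoint copies of $\mathit{St}_3(d,k)$ whose leaves lie outside $C_0$.
   Context: A $3$-graph is a $3$-uniform hypergraph. $\mathit{St}_3(h,k)$ is the $3$-graph with a vertex $v$ (the centre) contained in all edges such that removing $v$ from every edge yields $h$ vertex-disjoint copies of the graph star $S_k$ (star with $k$ leaves); its leaves are the $hk$ leaf vertices of these stars $S_k$. Non-integer quantities are rounded (floors omitted). -}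

module Defs where

open import Data.Nat using (ℕ; zero; suc; _+_; _*_; _^_; _≤_; _<_)
open import Data.Bool using (Bool; true; false; if_then_else_)
open import Data.Fin using (Fin; toℕ)
open import Data.Fin.Subset using (Subset; _∉_)
open import Data.Vec using (lookup)
open import Data.List using (List; length)
open import Data.List.Relation.Unary.All using (All)
open import Data.List.Relation.Unary.Unique.Propositional using (Unique)
open import Data.List.Membership.Propositional using (_∈_)
open import Data.Product using (Σ; _×_; _,_)
open import Data.Sum using (_⊎_)
open import Relation.Binary.PropositionalEquality using (_≡_; _≢_)
open import Function.Definitions using (Injective)

-- A 3-uniform hypergraph on vertex set Fin n: a duplicate-free list of edges,
-- each edge {x,y,z} stored once as a strictly increasing triple x < y < z.
Triple : ℕ → Set
Triple n = Fin n × Fin n × Fin n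

Increasing : {n : ℕ} → Triple n → Set
Increasing (x , y , z) = (toℕ x < toℕ y) × (toℕ y < toℕ z)

record ThreeGraph (n : ℕ) : Set where
  field
    edges      : List (Triple n)
    increasing : All Increasing edges
    unique     : Unique edges

open ThreeGraph public

numEdges : {n : ℕ} → ThreeGraph n → ℕ
numEdges H = length (edges H)

InTriple : {n : ℕ} → Fin n → Triple n → Set
InTriple a (x , y , z) = (a ≡ x) ⊎ (a ≡ y) ⊎ (a ≡ z)

HasEdge : {n : ℕ} → ThreeGraph n → Fin n → Fin n → Fin n → Set
HasEdge {n} H a b c =
  (a ≢ b) × (a ≢ c) × (b ≢ c) ×
  Σ (Triple n) λ e → (e ∈ edges H) × InTriple a e × InTriple b e × InTriple c e

ind : {n : ℕ} → Subset n → Fin n → ℕ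
ind C x = if lookup C x then 1 else 0

OneVertexIn : {n : ℕ} → ThreeGraph n → Subset n → Set
OneVertexIn H C = All (λ { (x , y , z) → ind C x + ind C y + ind C z ≡ 1 }) (edges H)

-- vertices of St_3(h,k): the centre v, the h centres of the stars S_k,
-- and the h*k leaves (leaf i j = j-th leaf of the i-th star).
data StVertex (h k : ℕ) : Set where
  centre : StVertex h k
  mid    : Fin h → StVertex h k
  leaf   : Fin h → Fin k → StVertex h k

-- m vertex-disjoint copies of St_3(h,k) in H whose leaves lie outside C:
-- an injective map from (copy index, vertex of St_3(h,k)) into V(H) sending
-- every edge {v, c_i, l_ij} of each copy onto an edge of H.
DisjointStars : {n : ℕ} → ThreeGraph n → Subset n → (m h k : ℕ) → Set
DisjointStars {n} H C m h k =
  Σ (Fin m × StVertex h k → Fin n) λ f →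
    Injective _≡_ _≡_ f ×
    (∀ c i j → HasEdge H (f (c , centre)) (f (c , mid i)) (f (c , leaf i j))) ×
    (∀ c i j → f (c , leaf i j) ∉ C)

module Submission where

-- A vertex v of degree at least n(K + D), K = |V(St₃(D,k))|, is the centre of a star St₃(D,k)
-- with leaves outside C₀: every edge through v yields a middle vertex u and a leaf r ∉ C₀, and as
-- pairs through v lie in at most n edges, at least D vertices u have K candidate leaves, from which
-- distinct middles and leaves are chosen greedily.
--
-- Call a vertex heavy if its degree is at least a threshold (larger for vertices in C₀). With D
-- heavy vertices, stars are grown around them in turn, each time first deleting all edges through
-- the vertices used so far and through the other heavy centres; codegrees are at most n, and at
-- most |C₀| for two vertices outside C₀, so the next centre keeps degree n(K + D). Otherwise the
-- heavy vertices are deleted; every star then consists of light vertices and costs few edges, and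
-- the remaining edges always leave a vertex of C₀ of degree n(K + D), since each edge has exactly
-- one vertex in C₀. The hypotheses make the total edge budget smaller than the number of edges.

open import Data.Nat using (ℕ; zero; suc; _+_; _*_; _^_; _≤_; _<_; z≤n; s≤s; _≤?_; NonZero; >-nonZero; >-nonZero⁻¹)
import Data.Nat as ℕ
open import Data.Nat.Properties hiding (_≟_)
open import Data.Nat.Solver using (module +-*-Solver)
open import Algebra.Properties.CommutativeSemigroup +-commutativeSemigroup using (interchange)
open import Data.Bool using (true; false; if_then_else_)
open import Data.Fin using (Fin; zero; suc; toℕ; fromℕ<; _≟_; combine; remQuot)
open import Data.Fin.Properties using (all?; any?; toℕ-injective; toℕ<n; toℕ-fromℕ<; remQuot-combine; combine-injective)
open import Data.Fin.Subset as Subset using (Subset; ∣_∣)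
open import Data.Fin.Subset.Properties using (∣p∣≤n)
open import Data.Vec using ([]; _∷_; lookup)
open import Data.Vec.Properties using ([]=⇒lookup; lookup⇒[]=)
open import Data.List using (List; []; _∷_; _++_; length; filter; map; concat; allFin)
open import Data.List.Properties using (length-++; length-tabulate; map-tabulate; length-filter; length-map)
open import Data.List.Membership.Propositional using (_∈_; _∉_; find)
open import Data.List.Membership.Propositional.Properties
  using (∈-allFin; ∈-∃++; ∈-++⁻; ∈-++⁺ˡ; ∈-++⁺ʳ; ∈-filter⁺; ∈-filter⁻; ∈-map⁺; ∈-map⁻; ∈-concat⁺′)
import Data.List.Membership.DecPropositional as DecMembership
import Data.List.Relation.Unary.Any as Any
open import Data.List.Relation.Unary.Any using (Any; here; there)
import Data.List.Relation.Unary.All as All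
open import Data.List.Relation.Unary.All.Properties using (filter⁺)
open import Data.List.Relation.Unary.AllPairs using (_∷_)
open import Data.List.Relation.Unary.Unique.Propositional using (Unique)
import Data.List.Relation.Unary.Unique.Propositional.Properties as Unique
open import Data.Product using (Σ; _×_; _,_; ∃; ∃₂; proj₁; proj₂; uncurry)
open import Data.Sum using (_⊎_; inj₁; inj₂; [_,_]′)
open import Data.Empty using (⊥; ⊥-elim)
open import Function using (id; _∘_)
open import Function.Definitions using (Injective)
open import Relation.Nullary using (Dec; yes; no; ¬_)
open import Relation.Nullary.Decidable using (toWitness; ¬?; _→-dec_; _⊎-dec_; _×-dec_)
open import Relation.Unary using (Pred; Decidable)
open import Relation.Binary.Definitions using (DecidableEquality)
open import Relation.Binary.PropositionalEquality
open import Defs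

open +-*-Solver

-- Sums and indicators

𝟙 : {P : Set} → Dec P → ℕ
𝟙 (yes _) = 1
𝟙 (no _)  = 0

𝟙≤1 : {P : Set} (d : Dec P) → 𝟙 d ≤ 1
𝟙≤1 (yes _) = ≤-refl
𝟙≤1 (no _)  = z≤n

𝟙-yes : {P : Set} (d : Dec P) → P → 𝟙 d ≡ 1
𝟙-yes (yes _) _ = refl
𝟙-yes (no ¬p) p = ⊥-elim (¬p p)

𝟙-witness : {P : Set} (d : Dec P) → 1 ≤ 𝟙 d → P
𝟙-witness (yes p) _ = p

1≤𝟙 : {P : Set} (d : Dec P) → P → 1 ≤ 𝟙 d
1≤𝟙 d p = ≤-reflexive (sym (𝟙-yes d p))

𝟙≤ : {P : Set} (d : Dec P) {m : ℕ} → (P → 1 ≤ m) → 𝟙 d ≤ m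
𝟙≤ (yes p) h = h p
𝟙≤ (no _)  h = z≤n

∑ : {A : Set} → List A → (A → ℕ) → ℕ
∑ []       f = 0
∑ (x ∷ xs) f = f x + ∑ xs f

syntax ∑ xs (λ x → e) = ∑[ x ∈ xs ] e

module _ {A : Set} where

  ∑-mono : ∀ (xs : List A) {f g : A → ℕ} → (∀ {x} → x ∈ xs → f x ≤ g x) → ∑ xs f ≤ ∑ xs g
  ∑-mono []       h = z≤n
  ∑-mono (x ∷ xs) h = +-mono-≤ (h (here refl)) (∑-mono xs (λ p → h (there p)))

  ∑-cong : ∀ (xs : List A) {f g : A → ℕ} → (∀ {x} → x ∈ xs → f x ≡ g x) → ∑ xs f ≡ ∑ xs g
  ∑-cong []       h = refl
  ∑-cong (x ∷ xs) h = cong₂ _+_ (h (here refl)) (∑-cong xs (λ p → h (there p)))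

  ∑-+ : ∀ (xs : List A) (f g : A → ℕ) → ∑[ x ∈ xs ] (f x + g x) ≡ ∑ xs f + ∑ xs g
  ∑-+ []       f g = refl
  ∑-+ (x ∷ xs) f g = trans (cong (f x + g x +_) (∑-+ xs f g)) (interchange (f x) (g x) _ _)

  *-distribˡ-∑ : ∀ (c : ℕ) (xs : List A) (f : A → ℕ) → c * ∑ xs f ≡ ∑[ x ∈ xs ] (c * f x)
  *-distribˡ-∑ c []       f = *-zeroʳ c
  *-distribˡ-∑ c (x ∷ xs) f = trans (*-distribˡ-+ c (f x) _) (cong (c * f x +_) (*-distribˡ-∑ c xs f))

  ∑-*-const : ∀ (xs : List A) (f : A → ℕ) (c : ℕ) → ∑ xs f * c ≡ ∑[ x ∈ xs ] (f x * c)
  ∑-*-const xs f c = trans (*-comm (∑ xs f) c) (trans (*-distribˡ-∑ c xs f) (∑-cong xs λ {x} _ → *-comm c (f x)))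

  ∑-const : ∀ (xs : List A) (c : ℕ) → ∑[ _ ∈ xs ] c ≡ length xs * c
  ∑-const []       c = refl
  ∑-const (x ∷ xs) c = cong (c +_) (∑-const xs c)

  ∑-≤-const : ∀ (xs : List A) {f : A → ℕ} (c : ℕ) → (∀ {x} → x ∈ xs → f x ≤ c) → ∑ xs f ≤ length xs * c
  ∑-≤-const xs c h = ≤-trans (∑-mono xs h) (≤-reflexive (∑-const xs c))

  ≤-∑ : ∀ {xs : List A} (f : A → ℕ) {x} → x ∈ xs → f x ≤ ∑ xs f
  ≤-∑ {y ∷ xs} f (here refl) = m≤m+n (f y) _
  ≤-∑ {y ∷ xs} f (there p)   = ≤-trans (≤-∑ f p) (m≤n+m _ (f y))

  +-≤-∑ : ∀ {xs : List A} (f : A → ℕ) {x y} → x ≢ y → x ∈ xs → y ∈ xs → f x + f y ≤ ∑ xs f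
  +-≤-∑ f x≢y (here refl) (here refl) = ⊥-elim (x≢y refl)
  +-≤-∑ f _   (here refl) (there y∈)  = +-monoʳ-≤ _ (≤-∑ f y∈)
  +-≤-∑ f {x} {y} _ (there x∈) (here refl) = ≤-trans (≤-reflexive (+-comm (f x) (f y))) (+-monoʳ-≤ _ (≤-∑ f x∈))
  +-≤-∑ {z ∷ _} f x≢y (there x∈) (there y∈) = ≤-trans (+-≤-∑ f x≢y x∈ y∈) (m≤n+m _ (f z))

  𝟙-≤-∑ : ∀ {P : Set} (d : Dec P) (xs : List A) (g : A → ℕ) → (P → ∃ λ x → x ∈ xs × 1 ≤ g x) → 𝟙 d ≤ ∑ xs g
  𝟙-≤-∑ d xs g witness = 𝟙≤ d λ p → let (x , x∈ , 1≤gx) = witness p in ≤-trans 1≤gx (≤-∑ g x∈)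

  ∑-++ : ∀ (xs ys : List A) (f : A → ℕ) → ∑ (xs ++ ys) f ≡ ∑ xs f + ∑ ys f
  ∑-++ []       ys f = refl
  ∑-++ (x ∷ xs) ys f = trans (cong (f x +_) (∑-++ xs ys f)) (sym (+-assoc (f x) _ _))

  ∑-filter : ∀ {P : Pred A _} (P? : Decidable P) (xs : List A) (f : A → ℕ) →
             ∑ (filter P? xs) f ≡ ∑[ x ∈ xs ] (𝟙 (P? x) * f x)
  ∑-filter P? []       f = refl
  ∑-filter P? (x ∷ xs) f with P? x
  ... | yes _ = cong₂ _+_ (sym (+-identityʳ (f x))) (∑-filter P? xs f)
  ... | no _  = ∑-filter P? xs f

  length-filter-∑ : ∀ {P : Pred A _} (P? : Decidable P) (xs : List A) →
                    length (filter P? xs) ≡ ∑[ x ∈ xs ] 𝟙 (P? x)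
  length-filter-∑ P? []       = refl
  length-filter-∑ P? (x ∷ xs) with P? x
  ... | yes _ = cong suc (length-filter-∑ P? xs)
  ... | no _  = length-filter-∑ P? xs

  ∑-positive : ∀ (xs : List A) (f : A → ℕ) → 1 ≤ ∑ xs f → ∃ λ x → x ∈ xs × 1 ≤ f x
  ∑-positive (x ∷ xs) f h with f x in fx
  ... | suc _ = x , here refl , ≤-trans (s≤s z≤n) (≤-reflexive (sym fx))
  ... | zero with ∑-positive xs f h
  ...   | y , y∈ , fy = y , there y∈ , fy

  ∑-≤1 : ∀ (xs : List A) (f : A → ℕ) → Unique xs → (∀ {x} → x ∈ xs → f x ≤ 1) →
         (∀ {x y} → x ∈ xs → y ∈ xs → 1 ≤ f x → 1 ≤ f y → x ≡ y) → ∑ xs f ≤ 1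
  ∑-≤1 []       f _          _   _    = z≤n
  ∑-≤1 (x ∷ xs) f (x∉ ∷ uxs) f≤1 same with f x in fx
  ... | zero  = ∑-≤1 xs f uxs (λ p → f≤1 (there p)) (λ p q → same (there p) (there q))
  ... | suc m = ≤-trans (+-mono-≤ (subst (_≤ 1) fx (f≤1 (here refl))) rest≤0) (≤-reflexive (+-identityʳ 1))
    where
    rest-zero : ∀ {y} → y ∈ xs → f y ≤ 0
    rest-zero {y} y∈ with f y in fy
    ... | zero  = z≤n
    ... | suc _ = ⊥-elim (All.lookup x∉ y∈ (same (here refl) (there y∈)
                    (≤-trans (s≤s z≤n) (≤-reflexive (sym fx))) (≤-trans (s≤s z≤n) (≤-reflexive (sym fy)))))
    rest≤0 : ∑ xs f ≤ 0
    rest≤0 = ≤-trans (∑-≤-const xs 0 rest-zero) (≤-reflexive (*-zeroʳ (length xs)))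

∑-comm : ∀ {A B : Set} (xs : List A) (ys : List B) (g : A → B → ℕ) →
         ∑[ x ∈ xs ] ∑ ys (g x) ≡ ∑[ y ∈ ys ] ∑[ x ∈ xs ] g x y
∑-comm []       ys g = sym (trans (∑-const ys 0) (*-zeroʳ (length ys)))
∑-comm (x ∷ xs) ys g = trans (cong (∑ ys (g x) +_) (∑-comm xs ys g))
                             (sym (∑-+ ys (g x) (λ y → ∑[ x ∈ xs ] g x y)))

∑-map : ∀ {A B : Set} (h : A → B) (xs : List A) (f : B → ℕ) → ∑ (map h xs) f ≡ ∑[ x ∈ xs ] f (h x)
∑-map h []       f = refl
∑-map h (x ∷ xs) f = cong (f (h x) +_) (∑-map h xs f)

∑-concat : ∀ {A : Set} (xss : List (List A)) (f : A → ℕ) → ∑ (concat xss) f ≡ ∑[ xs ∈ xss ] ∑ xs f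
∑-concat []         f = refl
∑-concat (xs ∷ xss) f = trans (∑-++ xs (concat xss) f) (cong (∑ xs f +_) (∑-concat xss f))

length-allFin : ∀ n → length (allFin n) ≡ n
length-allFin n = length-tabulate id

∑-allFin-≤ : ∀ {n} (f : Fin n → ℕ) (c : ℕ) → (∀ i → f i ≤ c) → ∑ (allFin n) f ≤ n * c
∑-allFin-≤ {n} f c h = ≤-trans (∑-≤-const (allFin n) c (λ {i} _ → h i)) (≤-reflexive (cong (_* c) (length-allFin n)))

∑-allFin-suc : ∀ {n} (f : Fin (suc n) → ℕ) → ∑ (allFin (suc n)) f ≡ f Fin.zero + ∑[ i ∈ allFin n ] f (Fin.suc i)
∑-allFin-suc {n} f = cong (f Fin.zero +_)
  (trans (cong (λ xs → ∑ xs f) (sym (map-tabulate id Fin.suc))) (∑-map Fin.suc (allFin n) f))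

∑-ind : ∀ {n} (C : Subset n) → ∑[ x ∈ allFin n ] ind C x ≡ ∣ C ∣
∑-ind {zero}  []          = refl
∑-ind {suc n} (true ∷ C)  = trans (∑-allFin-suc (ind (true ∷ C))) (cong suc (∑-ind C))
∑-ind {suc n} (false ∷ C) = trans (∑-allFin-suc (ind (false ∷ C))) (∑-ind C)

module _ {A : Set} (_≟_ : DecidableEquality A) where

  open DecMembership _≟_ using (_∈?_)

  ∃-∉-longer : ∀ (xs ys : List A) → Unique xs → length ys < length xs → ∃ λ z → z ∈ xs × z ∉ ys
  ∃-∉-longer (x ∷ xs) ys (x∉xs ∷ uxs) (s≤s ys≤xs) with x ∈? ys
  ... | no x∉ys = x , here refl , x∉ys
  ... | yes x∈ys with ∈-∃++ x∈ys
  ...   | ys₁ , ys₂ , refl with ∃-∉-longer xs (ys₁ ++ ys₂) uxs (≤-trans (≤-reflexive shorter) ys≤xs)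
    where
    shorter : suc (length (ys₁ ++ ys₂)) ≡ length (ys₁ ++ x ∷ ys₂)
    shorter = sym (trans (length-++ ys₁) (trans (+-suc (length ys₁) (length ys₂)) (cong suc (sym (length-++ ys₁)))))
  ...     | z , z∈xs , z∉ys = z , there z∈xs , z∉
    where
    z∉ : z ∉ ys₁ ++ x ∷ ys₂
    z∉ z∈ with ∈-++⁻ ys₁ z∈
    ... | inj₁ p           = z∉ys (∈-++⁺ˡ p)
    ... | inj₂ (here refl) = All.lookup x∉xs z∈xs refl
    ... | inj₂ (there p)   = z∉ys (∈-++⁺ʳ ys₁ p)

  -- Greedy choice: each candidate list is long enough to avoid F and all earlier representatives.
  distinct-representatives : ∀ {m} (F : List A) (N : Fin m → List A) → (∀ i → Unique (N i)) →
    (∀ i → length F + m ≤ length (N i)) →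
    Σ (Fin m → A) λ h → Injective _≡_ _≡_ h × (∀ i → h i ∈ N i × h i ∉ F)
  distinct-representatives {zero}  F N uN long = (λ ()) , (λ { {()} }) , (λ ())
  distinct-representatives {suc m} F N uN long
    with z , z∈N₀ , z∉F ← ∃-∉-longer (N zero) F (uN zero) (<-≤-trans (m<m+n (length F) (s≤s z≤n)) (long zero))
    with h , h-inj , h∈ ← distinct-representatives (z ∷ F) (λ i → N (suc i)) (λ i → uN (suc i))
                            (λ i → ≤-trans (≤-reflexive (sym (+-suc (length F) m))) (long (suc i)))
    = h′ , h′-inj , h′∈
    where
    h′ : Fin (suc m) → A
    h′ zero    = z
    h′ (suc i) = h i
    h′-inj : Injective _≡_ _≡_ h′
    h′-inj {zero}  {zero}  _  = refl
    h′-inj {zero}  {suc j} eq = ⊥-elim (proj₂ (h∈ j) (here (sym eq)))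
    h′-inj {suc i} {zero}  eq = ⊥-elim (proj₂ (h∈ i) (here eq))
    h′-inj {suc i} {suc j} eq = cong suc (h-inj eq)
    h′∈ : ∀ i → h′ i ∈ N i × h′ i ∉ F
    h′∈ zero    = z∈N₀ , z∉F
    h′∈ (suc i) = proj₁ (h∈ i) , λ p → proj₂ (h∈ i) (there p)

-- Triples

three-distinct-cover : ∀ (i j l m : Fin 3) → i ≢ j → i ≢ l → j ≢ l → m ≡ i ⊎ m ≡ j ⊎ m ≡ l
three-distinct-cover = toWitness {a? = all? λ i → all? λ j → all? λ l → all? λ m →
  ¬? (i ≟ j) →-dec ¬? (i ≟ l) →-dec ¬? (j ≟ l) →-dec (m ≟ i ⊎-dec m ≟ j ⊎-dec m ≟ l)} _

∃-third : ∀ (i j : Fin 3) → i ≢ j → ∃ λ l → l ≢ i × l ≢ j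
∃-third = toWitness {a? = all? λ i → all? λ j → ¬? (i ≟ j) →-dec any? λ l → ¬? (l ≟ i) ×-dec ¬? (l ≟ j)} _

∃-other : ∀ (i : Fin 3) → ∃ λ j → j ≢ i
∃-other = toWitness {a? = all? λ i → any? λ j → ¬? (j ≟ i)} _

module _ {n : ℕ} where

  vertexAt : Triple n → Fin 3 → Fin n
  vertexAt (x , y , z) zero          = x
  vertexAt (x , y , z) (suc zero)    = y
  vertexAt (x , y , z) (suc (suc _)) = z

  position : ∀ {a} (e : Triple n) → InTriple a e → Fin 3
  position e (inj₁ _)        = zero
  position e (inj₂ (inj₁ _)) = suc zero
  position e (inj₂ (inj₂ _)) = suc (suc zero)

  vertexAt-position : ∀ {a} (e : Triple n) (a∈ : InTriple a e) → vertexAt e (position e a∈) ≡ a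
  vertexAt-position e (inj₁ refl)        = refl
  vertexAt-position e (inj₂ (inj₁ refl)) = refl
  vertexAt-position e (inj₂ (inj₂ refl)) = refl

  vertexAt-InTriple : ∀ (e : Triple n) i → InTriple (vertexAt e i) e
  vertexAt-InTriple e zero             = inj₁ refl
  vertexAt-InTriple e (suc zero)       = inj₂ (inj₁ refl)
  vertexAt-InTriple e (suc (suc zero)) = inj₂ (inj₂ refl)

  toℕ<⇒≢ : ∀ {a b : Fin n} → toℕ a < toℕ b → a ≢ b
  toℕ<⇒≢ a<b refl = <-irrefl refl a<b

  vertexAt-injective : ∀ {e : Triple n} → Increasing e → Injective _≡_ _≡_ (vertexAt e)
  vertexAt-injective {e} (x<y , y<z) {i} {j} = go i j
    where
    go : ∀ i j → vertexAt e i ≡ vertexAt e j → i ≡ j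
    go zero             zero             _  = refl
    go zero             (suc zero)       eq = ⊥-elim (toℕ<⇒≢ x<y eq)
    go zero             (suc (suc zero)) eq = ⊥-elim (toℕ<⇒≢ (<-trans x<y y<z) eq)
    go (suc zero)       zero             eq = ⊥-elim (toℕ<⇒≢ x<y (sym eq))
    go (suc zero)       (suc zero)       _  = refl
    go (suc zero)       (suc (suc zero)) eq = ⊥-elim (toℕ<⇒≢ y<z eq)
    go (suc (suc zero)) zero             eq = ⊥-elim (toℕ<⇒≢ (<-trans x<y y<z) (sym eq))
    go (suc (suc zero)) (suc zero)       eq = ⊥-elim (toℕ<⇒≢ y<z (sym eq))
    go (suc (suc zero)) (suc (suc zero)) _  = refl

  position-injective : ∀ {a b} (e : Triple n) (a∈ : InTriple a e) (b∈ : InTriple b e) →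
                       position e a∈ ≡ position e b∈ → a ≡ b
  position-injective e a∈ b∈ eq =
    trans (sym (vertexAt-position e a∈)) (trans (cong (vertexAt e) eq) (vertexAt-position e b∈))

  InTriple-cover : ∀ {e : Triple n} {v u r x} → v ≢ u → v ≢ r → u ≢ r →
    InTriple v e → InTriple u e → InTriple r e → InTriple x e → x ≡ v ⊎ x ≡ u ⊎ x ≡ r
  InTriple-cover {e} v≢u v≢r u≢r v∈ u∈ r∈ x∈
    with three-distinct-cover (position e v∈) (position e u∈) (position e r∈) (position e x∈)
           (λ eq → v≢u (position-injective e v∈ u∈ eq)) (λ eq → v≢r (position-injective e v∈ r∈ eq))
           (λ eq → u≢r (position-injective e u∈ r∈ eq))
  ... | inj₁ eq        = inj₁ (position-injective e x∈ v∈ eq)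
  ... | inj₂ (inj₁ eq) = inj₂ (inj₁ (position-injective e x∈ u∈ eq))
  ... | inj₂ (inj₂ eq) = inj₂ (inj₂ (position-injective e x∈ r∈ eq))

  ∃-third-vertex : ∀ {e : Triple n} {v z} → Increasing e → InTriple v e → InTriple z e → v ≢ z →
                   ∃ λ r → InTriple r e × r ≢ v × r ≢ z
  ∃-third-vertex {e} inc v∈ z∈ v≢z
    with l , l≢v , l≢z ← ∃-third (position e v∈) (position e z∈) (λ eq → v≢z (position-injective e v∈ z∈ eq))
    = vertexAt e l , vertexAt-InTriple e l
    , (λ eq → l≢v (vertexAt-injective inc (trans eq (sym (vertexAt-position e v∈)))))
    , (λ eq → l≢z (vertexAt-injective inc (trans eq (sym (vertexAt-position e z∈)))))

  ∃-other-vertex : ∀ {e : Triple n} {v} → Increasing e → InTriple v e → ∃ λ u → InTriple u e × u ≢ v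
  ∃-other-vertex {e} inc v∈ with j , j≢v ← ∃-other (position e v∈)
    = vertexAt e j , vertexAt-InTriple e j
    , (λ eq → j≢v (vertexAt-injective inc (trans eq (sym (vertexAt-position e v∈)))))

  Increasing-unique : ∀ {e e′ : Triple n} → Increasing e → Increasing e′ →
    (∀ {x} → InTriple x e → InTriple x e′) → (∀ {x} → InTriple x e′ → InTriple x e) → e ≡ e′
  Increasing-unique {x , y , z} {x′ , y′ , z′} inc inc′ e⊆e′ e′⊆e =
    cong₂ _,_ x≡x′ (cong₂ _,_ y≡y′ z≡z′)
    where
    least : ∀ {a b c w : Fin n} → Increasing (a , b , c) → InTriple w (a , b , c) → toℕ a ≤ toℕ w
    least _         (inj₁ refl)        = ≤-refl
    least (a<b , _) (inj₂ (inj₁ refl)) = <⇒≤ a<b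
    least (a<b , b<c) (inj₂ (inj₂ refl)) = <⇒≤ (<-trans a<b b<c)
    greatest : ∀ {a b c w : Fin n} → Increasing (a , b , c) → InTriple w (a , b , c) → toℕ w ≤ toℕ c
    greatest (a<b , b<c) (inj₁ refl)        = <⇒≤ (<-trans a<b b<c)
    greatest (_ , b<c)   (inj₂ (inj₁ refl)) = <⇒≤ b<c
    greatest _           (inj₂ (inj₂ refl)) = ≤-refl
    x≡x′ : x ≡ x′
    x≡x′ = toℕ-injective (≤-antisym (least inc (e′⊆e (inj₁ refl))) (least inc′ (e⊆e′ (inj₁ refl))))
    z≡z′ : z ≡ z′
    z≡z′ = toℕ-injective (≤-antisym (greatest inc′ (e⊆e′ (inj₂ (inj₂ refl)))) (greatest inc (e′⊆e (inj₂ (inj₂ refl)))))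
    y≡y′ : y ≡ y′
    y≡y′ with e⊆e′ {y} (inj₂ (inj₁ refl))
    ... | inj₁ eq        = ⊥-elim (toℕ<⇒≢ (proj₁ inc) (trans x≡x′ (sym eq)))
    ... | inj₂ (inj₁ eq) = eq
    ... | inj₂ (inj₂ eq) = ⊥-elim (toℕ<⇒≢ (proj₂ inc) (trans eq (sym z≡z′)))

  Increasing-through : ∀ {e e′ : Triple n} {v u r} → Increasing e → Increasing e′ → v ≢ u → v ≢ r → u ≢ r →
    InTriple v e → InTriple u e → InTriple r e → InTriple v e′ → InTriple u e′ → InTriple r e′ → e ≡ e′
  Increasing-through {v = v} {u} {r} inc inc′ v≢u v≢r u≢r v∈ u∈ r∈ v∈′ u∈′ r∈′ =
    Increasing-unique inc inc′ (transport v∈ u∈ r∈ v∈′ u∈′ r∈′) (transport v∈′ u∈′ r∈′ v∈ u∈ r∈)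
    where
    transport : ∀ {e e′ : Triple n} → InTriple v e → InTriple u e → InTriple r e →
                InTriple v e′ → InTriple u e′ → InTriple r e′ → ∀ {x} → InTriple x e → InTriple x e′
    transport a b c a′ b′ c′ x∈ with InTriple-cover v≢u v≢r u≢r a b c x∈
    ... | inj₁ refl        = a′
    ... | inj₂ (inj₁ refl) = b′
    ... | inj₂ (inj₂ refl) = c′

-- Degrees and codegrees

module _ {n : ℕ} where

  InTriple? : (x : Fin n) (e : Triple n) → Dec (InTriple x e)
  InTriple? x (p , q , s) = x ≟ p ⊎-dec x ≟ q ⊎-dec x ≟ s

  vertices : Triple n → List (Fin n)
  vertices (p , q , s) = p ∷ q ∷ s ∷ []

  ∈-vertices⁺ : ∀ {x} {e : Triple n} → InTriple x e → x ∈ vertices e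
  ∈-vertices⁺ (inj₁ refl)        = here refl
  ∈-vertices⁺ (inj₂ (inj₁ refl)) = there (here refl)
  ∈-vertices⁺ (inj₂ (inj₂ refl)) = there (there (here refl))

  ∈-vertices⁻ : ∀ {x} {e : Triple n} → x ∈ vertices e → InTriple x e
  ∈-vertices⁻ (here refl)                 = inj₁ refl
  ∈-vertices⁻ (there (here refl))         = inj₂ (inj₁ refl)
  ∈-vertices⁻ (there (there (here refl))) = inj₂ (inj₂ refl)

  ∑-vertices : ∀ (p q s : Fin n) (f : Fin n → ℕ) → ∑ (vertices (p , q , s)) f ≡ f p + f q + f s
  ∑-vertices p q s f = trans (cong (λ m → f p + (f q + m)) (+-identityʳ (f s))) (sym (+-assoc (f p) (f q) (f s)))

  Through? : (v u r : Fin n) (e : Triple n) → Dec (InTriple v e × InTriple u e × InTriple r e)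
  Through? v u r e = InTriple? v e ×-dec InTriple? u e ×-dec InTriple? r e

  meets? : (X : List (Fin n)) (e : Triple n) → Dec (Any (λ z → InTriple z e) X)
  meets? X e = Any.any? (λ z → InTriple? z e) X

  avoids? : (X : List (Fin n)) (e : Triple n) → Dec (¬ Any (λ z → InTriple z e) X)
  avoids? X e = ¬? (meets? X e)

  -- Deleting the vertices X keeps them in the vertex set Fin n but removes every edge meeting X.
  _∖_ : ThreeGraph n → List (Fin n) → ThreeGraph n
  G ∖ X = record
    { edges      = filter (avoids? X) (edges G)
    ; increasing = filter⁺ (avoids? X) (increasing G)
    ; unique     = Unique.filter⁺ (avoids? X) (unique G)
    }

  module _ (G : ThreeGraph n) where

    degree : Fin n → ℕ
    degree v = ∑[ e ∈ edges G ] 𝟙 (InTriple? v e)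

    codegree : Fin n → Fin n → ℕ
    codegree v u = ∑[ e ∈ edges G ] 𝟙 (InTriple? v e ×-dec InTriple? u e)

    codegree₃ : Fin n → Fin n → Fin n → ℕ
    codegree₃ v u r = ∑[ e ∈ edges G ] 𝟙 (Through? v u r e)

    Increasing-edge : ∀ {e} → e ∈ edges G → Increasing e
    Increasing-edge = All.lookup (increasing G)

    codegree₃-≤1 : ∀ {v u r} → v ≢ u → v ≢ r → u ≢ r → codegree₃ v u r ≤ 1
    codegree₃-≤1 {v} {u} {r} v≢u v≢r u≢r = ∑-≤1 (edges G) _ (unique G) (λ {e} _ → 𝟙≤1 (Through? v u r e)) same
      where
      same : ∀ {e e′} → e ∈ edges G → e′ ∈ edges G → 1 ≤ 𝟙 (Through? v u r e) → 1 ≤ 𝟙 (Through? v u r e′) → e ≡ e′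
      same {e} {e′} e∈ e′∈ through through′
        with v∈ , u∈ , r∈ ← 𝟙-witness (Through? v u r e) through
           | v∈′ , u∈′ , r∈′ ← 𝟙-witness (Through? v u r e′) through′
        = Increasing-through (Increasing-edge e∈) (Increasing-edge e′∈) v≢u v≢r u≢r v∈ u∈ r∈ v∈′ u∈′ r∈′

    codegree-≤-∑-codegree₃ : ∀ {v z} → v ≢ z → {B : Fin n → Set} (B? : ∀ r → Dec (B r)) →
      (∀ {e r} → e ∈ edges G → InTriple v e → InTriple z e → InTriple r e → r ≢ v → r ≢ z → B r) →
      codegree v z ≤ ∑[ r ∈ allFin n ] (𝟙 (B? r) * codegree₃ v z r)
    codegree-≤-∑-codegree₃ {v} {z} v≢z B? third-in-B =
      ≤-trans (∑-mono (edges G) per-edge) (≤-reflexive (trans (∑-comm (edges G) (allFin n) _)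
        (∑-cong (allFin n) λ {r} _ → sym (*-distribˡ-∑ (𝟙 (B? r)) (edges G) _))))
      where
      per-edge : ∀ {e} → e ∈ edges G → 𝟙 (InTriple? v e ×-dec InTriple? z e) ≤ ∑[ r ∈ allFin n ] (𝟙 (B? r) * 𝟙 (Through? v z r e))
      per-edge {e} e∈ = 𝟙-≤-∑ (InTriple? v e ×-dec InTriple? z e) (allFin n) _ λ (v∈ , z∈) →
        let (r , r∈ , r≢v , r≢z) = ∃-third-vertex (Increasing-edge e∈) v∈ z∈ v≢z
        in r , ∈-allFin r , *-mono-≤ (1≤𝟙 (B? r) (third-in-B e∈ v∈ z∈ r∈ r≢v r≢z)) (1≤𝟙 (Through? v z r e) (v∈ , z∈ , r∈))

    codegree-≤ : ∀ {v z} → v ≢ z → codegree v z ≤ n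
    codegree-≤ {v} {z} v≢z = ≤-trans (codegree-≤-∑-codegree₃ v≢z B? (λ _ _ _ _ r≢v r≢z → r≢v , r≢z))
      (≤-trans (∑-allFin-≤ _ 1 term-≤1) (≤-reflexive (*-identityʳ n)))
      where
      B? : ∀ r → Dec (r ≢ v × r ≢ z)
      B? r = ¬? (r ≟ v) ×-dec ¬? (r ≟ z)
      term-≤1 : ∀ r → 𝟙 (B? r) * codegree₃ v z r ≤ 1
      term-≤1 r with B? r
      ... | no _             = z≤n
      ... | yes (r≢v , r≢z) = ≤-trans (≤-reflexive (+-identityʳ _)) (codegree₃-≤1 v≢z (≢-sym r≢v) (≢-sym r≢z))

    degree-≤-∑-codegree : ∀ v → degree v ≤ ∑[ u ∈ allFin n ] (𝟙 (¬? (u ≟ v)) * codegree v u)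
    degree-≤-∑-codegree v = ≤-trans (∑-mono (edges G) per-edge) (≤-reflexive (trans (∑-comm (edges G) (allFin n) _)
        (∑-cong (allFin n) λ {u} _ → sym (*-distribˡ-∑ (𝟙 (¬? (u ≟ v))) (edges G) _))))
      where
      per-edge : ∀ {e} → e ∈ edges G → 𝟙 (InTriple? v e) ≤ ∑[ u ∈ allFin n ] (𝟙 (¬? (u ≟ v)) * 𝟙 (InTriple? v e ×-dec InTriple? u e))
      per-edge {e} e∈ = 𝟙-≤-∑ (InTriple? v e) (allFin n) _ λ v∈ →
        let (u , u∈ , u≢v) = ∃-other-vertex (Increasing-edge e∈) v∈
        in u , ∈-allFin u , *-mono-≤ (1≤𝟙 (¬? (u ≟ v)) u≢v) (1≤𝟙 (InTriple? v e ×-dec InTriple? u e) (v∈ , u∈))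

    degree-≤ : ∀ v → degree v ≤ n * n
    degree-≤ v = ≤-trans (degree-≤-∑-codegree v) (∑-allFin-≤ _ n term-≤n)
      where
      term-≤n : ∀ u → 𝟙 (¬? (u ≟ v)) * codegree v u ≤ n
      term-≤n u with u ≟ v
      ... | yes _  = z≤n
      ... | no u≢v = ≤-trans (≤-reflexive (+-identityʳ _)) (codegree-≤ (≢-sym u≢v))

  module _ (G : ThreeGraph n) (X : List (Fin n)) where

    ∖-⊆ : ∀ {e} → e ∈ edges (G ∖ X) → e ∈ edges G
    ∖-⊆ e∈ = proj₁ (∈-filter⁻ (avoids? X) {xs = edges G} e∈)

    ∖-avoids : ∀ {e w} → e ∈ edges (G ∖ X) → InTriple w e → w ∉ X
    ∖-avoids e∈ w∈e w∈X = proj₂ (∈-filter⁻ (avoids? X) {xs = edges G} e∈) (Any.map (λ { refl → w∈e }) w∈X)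

    degree-∖ : ∀ v → degree G v ≤ degree (G ∖ X) v + ∑[ z ∈ X ] codegree G v z
    degree-∖ v = ≤-trans (∑-mono (edges G) per-edge) (≤-reflexive (trans (∑-+ (edges G) _ _)
        (cong₂ _+_ (sym (∑-filter (avoids? X) (edges G) _)) (∑-comm (edges G) X _))))
      where
      per-edge : ∀ {e} → e ∈ edges G → 𝟙 (InTriple? v e) ≤
                 𝟙 (avoids? X e) * 𝟙 (InTriple? v e) + ∑[ z ∈ X ] 𝟙 (InTriple? v e ×-dec InTriple? z e)
      per-edge {e} _ = 𝟙≤ (InTriple? v e) λ v∈ → case-meets v∈
        where
        case-meets : InTriple v e → 1 ≤ 𝟙 (avoids? X e) * 𝟙 (InTriple? v e) + ∑[ z ∈ X ] 𝟙 (InTriple? v e ×-dec InTriple? z e)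
        case-meets v∈ with meets? X e
        ... | no _ = ≤-trans (≤-reflexive (sym (trans (+-identityʳ _) (𝟙-yes (InTriple? v e) v∈)))) (m≤m+n _ _)
        ... | yes meet with z , z∈X , z∈ ← find meet = ≤-trans (1≤𝟙 (InTriple? v e ×-dec InTriple? z e) (v∈ , z∈)) (≤-∑ _ z∈X)

    numEdges-∖ : numEdges G ≤ numEdges (G ∖ X) + ∑[ z ∈ X ] degree G z
    numEdges-∖ = ≤-trans (≤-reflexive (sym (trans (∑-const (edges G) 1) (*-identityʳ _))))
      (≤-trans (∑-mono (edges G) per-edge) (≤-reflexive (trans (∑-+ (edges G) _ _)
        (cong₂ _+_ (sym (length-filter-∑ (avoids? X) (edges G))) (∑-comm (edges G) X _)))))
      where
      per-edge : ∀ {e} → e ∈ edges G → 1 ≤ 𝟙 (avoids? X e) + ∑[ z ∈ X ] 𝟙 (InTriple? z e)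
      per-edge {e} _ with meets? X e
      ... | no _ = s≤s z≤n
      ... | yes meet with z , z∈X , z∈ ← find meet = ≤-trans (1≤𝟙 (InTriple? z e) z∈) (≤-∑ _ z∈X)

  module _ (G : ThreeGraph n) (C : Subset n) (one : OneVertexIn G C) where

    ∑-ind-edge : ∀ {e} → e ∈ edges G → ∑ (vertices e) (ind C) ≡ 1
    ∑-ind-edge {p , q , s} e∈ = trans (∑-vertices p q s (ind C)) (All.lookup one e∈)

    ∃-vertex-in : ∀ {e} → e ∈ edges G → ∃ λ w → InTriple w e × 1 ≤ ind C w
    ∃-vertex-in {e} e∈ with w , w∈ , 1≤w ← ∑-positive (vertices e) (ind C) (≤-reflexive (sym (∑-ind-edge e∈)))
      = w , ∈-vertices⁻ w∈ , 1≤w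

    vertex-in-unique : ∀ {e v w} → e ∈ edges G → v ≢ w → InTriple v e → InTriple w e → 1 ≤ ind C v → 1 ≤ ind C w → ⊥
    vertex-in-unique {e} e∈ v≢w v∈ w∈ 1≤v 1≤w = <-irrefl refl (≤-trans (+-mono-≤ 1≤v 1≤w)
      (≤-trans (+-≤-∑ (ind C) v≢w (∈-vertices⁺ v∈) (∈-vertices⁺ w∈)) (≤-reflexive (∑-ind-edge e∈))))

    -- The third vertex of an edge through two vertices outside C lies in C.
    codegree-≤-∣C∣ : ∀ {v z} → v ≢ z → ind C v ≡ 0 → ind C z ≡ 0 → codegree G v z ≤ ∣ C ∣
    codegree-≤-∣C∣ {v} {z} v≢z v∉ z∉ = ≤-trans (codegree-≤-∑-codegree₃ G v≢z B? third-in)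
      (≤-trans (∑-mono (allFin n) λ {r} _ → term-≤ r) (≤-reflexive (∑-ind C)))
      where
      B? : ∀ r → Dec (1 ≤ ind C r × r ≢ v × r ≢ z)
      B? r = 1 ≤? ind C r ×-dec ¬? (r ≟ v) ×-dec ¬? (r ≟ z)
      third-in : ∀ {e r} → e ∈ edges G → InTriple v e → InTriple z e → InTriple r e → r ≢ v → r ≢ z →
                 1 ≤ ind C r × r ≢ v × r ≢ z
      third-in e∈ v∈ z∈ r∈ r≢v r≢z with w , w∈ , 1≤w ← ∃-vertex-in e∈
        with InTriple-cover v≢z (≢-sym r≢v) (≢-sym r≢z) v∈ z∈ r∈ w∈
      ... | inj₁ refl        = ⊥-elim (1+n≰n (≤-trans 1≤w (≤-reflexive v∉)))
      ... | inj₂ (inj₁ refl) = ⊥-elim (1+n≰n (≤-trans 1≤w (≤-reflexive z∉)))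
      ... | inj₂ (inj₂ refl) = 1≤w , r≢v , r≢z
      term-≤ : ∀ r → 𝟙 (B? r) * codegree₃ G v z r ≤ ind C r
      term-≤ r with B? r
      ... | no _ = z≤n
      ... | yes (1≤r , r≢v , r≢z) = ≤-trans (≤-reflexive (+-identityʳ _))
                                      (≤-trans (codegree₃-≤1 G v≢z (≢-sym r≢v) (≢-sym r≢z)) 1≤r)

    numEdges-≤-∑-degree : numEdges G ≤ ∑[ x ∈ allFin n ] (ind C x * degree G x)
    numEdges-≤-∑-degree = ≤-trans (≤-reflexive (sym (trans (∑-const (edges G) 1) (*-identityʳ _))))
      (≤-trans (∑-mono (edges G) per-edge) (≤-reflexive (trans (∑-comm (edges G) (allFin n) _)
        (∑-cong (allFin n) λ {x} _ → sym (*-distribˡ-∑ (ind C x) (edges G) _)))))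
      where
      per-edge : ∀ {e} → e ∈ edges G → 1 ≤ ∑[ x ∈ allFin n ] (ind C x * 𝟙 (InTriple? x e))
      per-edge {e} e∈ with w , w∈ , 1≤w ← ∃-vertex-in e∈ =
        ≤-trans (*-mono-≤ 1≤w (1≤𝟙 (InTriple? w e) w∈)) (≤-∑ _ (∈-allFin w))

    -- Every edge is counted at its vertex in C.
    ∃-vertex-in-of-degree : ∀ t → ∣ C ∣ * t < numEdges G → ∃ λ x → 1 ≤ ind C x × t ≤ degree G x
    ∃-vertex-in-of-degree t many with any? (λ x → 1 ≤? ind C x ×-dec t ≤? degree G x)
    ... | yes found = found
    ... | no none = ⊥-elim (<-irrefl refl (<-≤-trans many (≤-trans numEdges-≤-∑-degree
          (≤-trans (∑-mono (allFin n) λ {x} _ → term-≤ x) (≤-reflexive (trans (sym (∑-*-const (allFin n) (ind C) t))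
            (cong (_* t) (∑-ind C))))))))
      where
      term-≤ : ∀ x → ind C x * degree G x ≤ ind C x * t
      term-≤ x with 1 ≤? ind C x
      ... | no  x-out = let ind≡0 = n<1⇒n≡0 (≰⇒> x-out) in
                        ≤-reflexive (trans (cong (_* degree G x) ind≡0) (sym (cong (_* t) ind≡0)))
      ... | yes x-in  = *-monoʳ-≤ (ind C x) (<⇒≤ (≰⇒> λ t≤ → none (x , x-in , t≤)))

  OneVertexIn-∖ : ∀ (G : ThreeGraph n) (C : Subset n) (X : List (Fin n)) → OneVertexIn G C → OneVertexIn (G ∖ X) C
  OneVertexIn-∖ G C X = filter⁺ (avoids? X)

-- Stars

module _ {n : ℕ} where

  HasEdge-mono : ∀ {G G′ : ThreeGraph n} → (∀ {e} → e ∈ edges G → e ∈ edges G′) →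
                 ∀ {a b c} → HasEdge G a b c → HasEdge G′ a b c
  HasEdge-mono G⊆G′ (a≢b , a≢c , b≢c , e , e∈ , a∈ , b∈ , c∈) = a≢b , a≢c , b≢c , e , G⊆G′ e∈ , a∈ , b∈ , c∈

  record IsStar (G : ThreeGraph n) (C : Subset n) (h k : ℕ) (g : StVertex h k → Fin n) : Set where
    field
      injective : Injective _≡_ _≡_ g
      edge      : ∀ i j → HasEdge G (g centre) (g (mid i)) (g (leaf i j))
      leaf-out  : ∀ i j → g (leaf i j) Subset.∉ C

  ind≡0⇒∉ : ∀ {C : Subset n} {x} → ind C x ≡ 0 → x Subset.∉ C
  ind≡0⇒∉ {C} {x} ind≡0 x∈C with lookup C x | []=⇒lookup x∈C
  ind≡0⇒∉ () x∈C | true | _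

  starMap : ∀ {h k} → Fin n → (Fin h → Fin n) → (Fin h → Fin k → Fin n) → StVertex h k → Fin n
  starMap v m ℓ centre     = v
  starMap v m ℓ (mid i)    = m i
  starMap v m ℓ (leaf i j) = ℓ i j

  starMap-injective : ∀ {h k v} {m : Fin h → Fin n} {ℓ : Fin h → Fin k → Fin n} → (∀ i → m i ≢ v) →
    Injective _≡_ _≡_ m → (∀ {i j i′ j′} → ℓ i j ≡ ℓ i′ j′ → i ≡ i′ × j ≡ j′) →
    (∀ i j → ℓ i j ∉ v ∷ map m (allFin h)) → Injective _≡_ _≡_ (starMap v m ℓ)
  starMap-injective {h} {k} {v} {m} {ℓ} m≢v m-inj ℓ-inj ℓ∉ = injective
    where
    m∈ : ∀ i → m i ∈ v ∷ map m (allFin h)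
    m∈ i = there (∈-map⁺ m (∈-allFin i))
    injective : Injective _≡_ _≡_ (starMap v m ℓ)
    injective {centre}   {centre}     _  = refl
    injective {centre}   {mid i}      eq = ⊥-elim (m≢v i (sym eq))
    injective {centre}   {leaf i j}   eq = ⊥-elim (ℓ∉ i j (here (sym eq)))
    injective {mid i}    {centre}     eq = ⊥-elim (m≢v i eq)
    injective {mid i}    {mid i′}     eq = cong mid (m-inj eq)
    injective {mid i}    {leaf i′ j′} eq = ⊥-elim (ℓ∉ i′ j′ (subst (_∈ v ∷ map m (allFin h)) eq (m∈ i)))
    injective {leaf i j} {centre}     eq = ⊥-elim (ℓ∉ i j (here eq))
    injective {leaf i j} {mid i′}     eq = ⊥-elim (ℓ∉ i j (subst (_∈ v ∷ map m (allFin h)) (sym eq) (m∈ i′)))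
    injective {leaf i j} {leaf i′ j′} eq = uncurry (cong₂ leaf) (ℓ-inj eq)

  module StarAt (G : ThreeGraph n) (C : Subset n) (one : OneVertexIn G C) (h k : ℕ) (v : Fin n) where

    order : ℕ
    order = 1 + h + h * k

    -- v, u, r can serve as centre, middle vertex and leaf of a star.
    Spoke : Fin n → Fin n → Set
    Spoke u r = (u ≢ v × r ≢ v × r ≢ u) × ind C r ≡ 0

    Spoke? : ∀ u r → Dec (Spoke u r)
    Spoke? u r = (¬? (u ≟ v) ×-dec ¬? (r ≟ v) ×-dec ¬? (r ≟ u)) ×-dec ind C r ℕ.≟ 0

    Candidate? : ∀ u r → Dec (Spoke u r × 1 ≤ codegree₃ G v u r)
    Candidate? u r = Spoke? u r ×-dec 1 ≤? codegree₃ G v u r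

    candidates : Fin n → List (Fin n)
    candidates u = filter (Candidate? u) (allFin n)

    weight : Fin n → ℕ
    weight u = ∑[ r ∈ allFin n ] (𝟙 (Spoke? u r) * codegree₃ G v u r)

    weight-≤ : ∀ u → weight u ≤ length (candidates u)
    weight-≤ u = ≤-trans (∑-mono (allFin n) λ {r} _ → term-≤ r) (≤-reflexive (sym (length-filter-∑ (Candidate? u) (allFin n))))
      where
      term-≤ : ∀ r → 𝟙 (Spoke? u r) * codegree₃ G v u r ≤ 𝟙 (Candidate? u r)
      term-≤ r with Spoke? u r
      ... | no _ = z≤n
      ... | yes ((u≢v , r≢v , r≢u) , _) with 1 ≤? codegree₃ G v u r
      ...   | yes _  = ≤-trans (≤-reflexive (+-identityʳ _)) (codegree₃-≤1 G (≢-sym u≢v) (≢-sym r≢v) (≢-sym r≢u))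
      ...   | no 1≰ = ≤-trans (≤-reflexive (+-identityʳ _)) (≤-reflexive (n<1⇒n≡0 (≰⇒> 1≰)))

    -- Of the two other vertices of an edge through v at most one lies in C; the other one is the leaf.
    ∃-spoke : ∀ {e} → e ∈ edges G → InTriple v e → ∃₂ λ u r → Spoke u r × InTriple v e × InTriple u e × InTriple r e
    ∃-spoke e∈ v∈ with y , y∈ , y≢v ← ∃-other-vertex (Increasing-edge G e∈) v∈
      with z , z∈ , z≢v , z≢y ← ∃-third-vertex (Increasing-edge G e∈) v∈ y∈ (≢-sym y≢v)
      with ind C y ℕ.≟ 0
    ... | yes y-out = z , y , ((z≢v , y≢v , ≢-sym z≢y) , y-out) , v∈ , z∈ , y∈
    ... | no y-in = y , z , ((y≢v , z≢v , z≢y) , z-out) , v∈ , y∈ , z∈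
      where
      z-out : ind C z ≡ 0
      z-out with ind C z ℕ.≟ 0
      ... | yes z-out = z-out
      ... | no z-in = ⊥-elim (vertex-in-unique G C one e∈ (≢-sym z≢y) y∈ z∈ (n≢0⇒n>0 y-in) (n≢0⇒n>0 z-in))

    degree-≤-∑-weight : degree G v ≤ ∑[ u ∈ allFin n ] weight u
    degree-≤-∑-weight = ≤-trans (∑-mono (edges G) per-edge) (≤-reflexive regroup)
      where
      term : Fin n → Fin n → Triple n → ℕ
      term u r e = 𝟙 (Spoke? u r) * 𝟙 (Through? v u r e)
      per-edge : ∀ {e} → e ∈ edges G → 𝟙 (InTriple? v e) ≤ ∑[ u ∈ allFin n ] ∑[ r ∈ allFin n ] term u r e
      per-edge {e} e∈ = 𝟙≤ (InTriple? v e) λ v∈ → counted (∃-spoke e∈ v∈)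
        where
        counted : (∃₂ λ u r → Spoke u r × InTriple v e × InTriple u e × InTriple r e) →
                  1 ≤ ∑[ u ∈ allFin n ] ∑[ r ∈ allFin n ] term u r e
        counted (u , r , spoke , through) =
          ≤-trans (*-mono-≤ (1≤𝟙 (Spoke? u r) spoke) (1≤𝟙 (Through? v u r e) through))
            (≤-trans (≤-∑ (λ r → term u r e) (∈-allFin r)) (≤-∑ (λ u → ∑[ r ∈ allFin n ] term u r e) (∈-allFin u)))
      regroup : ∑[ e ∈ edges G ] ∑[ u ∈ allFin n ] ∑[ r ∈ allFin n ] term u r e ≡ ∑[ u ∈ allFin n ] weight u
      regroup = let open ≡-Reasoning in begin
        ∑[ e ∈ edges G ] ∑[ u ∈ allFin n ] ∑[ r ∈ allFin n ] term u r e
          ≡⟨ ∑-comm (edges G) (allFin n) _ ⟩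
        ∑[ u ∈ allFin n ] ∑[ e ∈ edges G ] ∑[ r ∈ allFin n ] term u r e
          ≡⟨ ∑-cong (allFin n) (λ {u} _ → ∑-comm (edges G) (allFin n) (λ e r → term u r e)) ⟩
        ∑[ u ∈ allFin n ] ∑[ r ∈ allFin n ] ∑[ e ∈ edges G ] term u r e
          ≡⟨ ∑-cong (allFin n) (λ {u} _ → ∑-cong (allFin n) λ {r} _ → sym (*-distribˡ-∑ (𝟙 (Spoke? u r)) (edges G) _)) ⟩
        ∑[ u ∈ allFin n ] weight u ∎

    rich? : ∀ u → Dec (order ≤ length (candidates u))
    rich? u = order ≤? length (candidates u)

    rich : List (Fin n)
    rich = filter rich? (allFin n)

    ∑-weight-≤ : ∑[ u ∈ allFin n ] weight u ≤ length rich * n + n * order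
    ∑-weight-≤ = ≤-trans (∑-mono (allFin n) λ {u} _ → weight-split u) (≤-reflexive (let open ≡-Reasoning in begin
      ∑[ u ∈ allFin n ] (𝟙 (rich? u) * n + order)
        ≡⟨ ∑-+ (allFin n) _ _ ⟩
      ∑[ u ∈ allFin n ] (𝟙 (rich? u) * n) + ∑[ _ ∈ allFin n ] order
        ≡⟨ cong₂ _+_ (∑-cong (allFin n) λ {u} _ → *-comm (𝟙 (rich? u)) n) (∑-const (allFin n) order) ⟩
      ∑[ u ∈ allFin n ] (n * 𝟙 (rich? u)) + length (allFin n) * order
        ≡⟨ cong₂ _+_ (sym (*-distribˡ-∑ n (allFin n) _)) (cong (_* order) (length-allFin n)) ⟩
      n * ∑[ u ∈ allFin n ] 𝟙 (rich? u) + n * order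
        ≡⟨ cong (_+ n * order) (trans (*-comm n _) (cong (_* n) (sym (length-filter-∑ rich? (allFin n))))) ⟩
      length rich * n + n * order ∎))
      where
      weight-split : ∀ u → weight u ≤ 𝟙 (rich? u) * n + order
      weight-split u with rich? u
      ... | yes _ = ≤-trans (weight-≤ u) (≤-trans (≤-trans (length-filter (Candidate? u) (allFin n))
                      (≤-reflexive (trans (length-allFin n) (sym (+-identityʳ n))))) (m≤m+n _ order))
      ... | no poor = ≤-trans (weight-≤ u) (<⇒≤ (≰⇒> poor))

    length-rich : n * (order + h) ≤ degree G v → h ≤ length rich
    length-rich deg≥ = *-cancelˡ-≤ n {{n-nonZero}} (+-cancelʳ-≤ (n * order) (n * h) (n * length rich) (begin
      n * h + n * order        ≡⟨ trans (+-comm (n * h) (n * order)) (sym (*-distribˡ-+ n order h)) ⟩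
      n * (order + h)          ≤⟨ deg≥ ⟩
      degree G v               ≤⟨ degree-≤-∑-weight ⟩
      ∑[ u ∈ allFin n ] weight u ≤⟨ ∑-weight-≤ ⟩
      length rich * n + n * order ≡⟨ cong (_+ n * order) (*-comm (length rich) n) ⟩
      n * length rich + n * order ∎))
      where
      open ≤-Reasoning
      n-nonZero : NonZero n
      n-nonZero = ℕ.>-nonZero (≤-trans (s≤s z≤n) (toℕ<n v))

    candidate⇒spoke : ∀ {u r} → r ∈ candidates u → Spoke u r × 1 ≤ codegree₃ G v u r
    candidate⇒spoke {u} r∈ = proj₂ (∈-filter⁻ (Candidate? u) {xs = allFin n} r∈)

    candidate⇒HasEdge : ∀ {u r} → r ∈ candidates u → HasEdge G v u r
    candidate⇒HasEdge {u} {r} r∈ with ((u≢v , r≢v , r≢u) , _) , 1≤codeg ← candidate⇒spoke r∈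
      with e , e∈ , through ← ∑-positive (edges G) (𝟙 ∘ Through? v u r) 1≤codeg
      = ≢-sym u≢v , ≢-sym r≢v , ≢-sym r≢u , e , e∈ , 𝟙-witness (Through? v u r e) through

    rich⇒≢v : ∀ {u} → u ∈ rich → u ≢ v
    rich⇒≢v {u} u∈ = nonempty (proj₂ (∈-filter⁻ rich? {xs = allFin n} u∈)) (λ {r} → candidate⇒spoke {u} {r})
      where
      nonempty : ∀ {rs : List (Fin n)} → order ≤ length rs → (∀ {r} → r ∈ rs → Spoke u r × 1 ≤ codegree₃ G v u r) → u ≢ v
      nonempty {r ∷ _} _ spokes = proj₁ (proj₁ (proj₁ (spokes (here refl))))

    -- The h * k leaves are chosen in one greedy pass, their slots being indexed through combine.
    leaves-for : (m : Fin h → Fin n) → (∀ i → m i ∈ rich) →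
      Σ (Fin h → Fin k → Fin n) λ ℓ → (∀ {i j i′ j′} → ℓ i j ≡ ℓ i′ j′ → i ≡ i′ × j ≡ j′) ×
        (∀ i j → ℓ i j ∈ candidates (m i) × ℓ i j ∉ v ∷ map m (allFin h))
    leaves-for m m∈rich = (λ i j → proj₁ chosen (combine i j))
      , (λ {i} {j} {i′} {j′} eq → combine-injective i j i′ j′ (proj₁ (proj₂ chosen) eq))
      , λ i j → subst (λ p → proj₁ chosen (combine i j) ∈ candidates (m (proj₁ p))) (remQuot-combine i j)
                      (proj₁ (proj₂ (proj₂ chosen) (combine i j)))
              , proj₂ (proj₂ (proj₂ chosen) (combine i j))
      where
      forbidden : List (Fin n)
      forbidden = v ∷ map m (allFin h)
      length-forbidden : length forbidden + h * k ≡ order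
      length-forbidden = cong (λ l → suc l + h * k) (trans (length-map m (allFin h)) (length-allFin h))
      chosen : Σ (Fin (h * k) → Fin n) λ ℓ → Injective _≡_ _≡_ ℓ ×
                 (∀ s → ℓ s ∈ candidates (m (proj₁ (remQuot k s))) × ℓ s ∉ forbidden)
      chosen = distinct-representatives _≟_ forbidden (λ s → candidates (m (proj₁ (remQuot k s))))
                 (λ _ → Unique.filter⁺ (Candidate? _) (Unique.allFin⁺ n))
                 (λ s → ≤-trans (≤-reflexive length-forbidden) (proj₂ (∈-filter⁻ rich? {xs = allFin n} (m∈rich _))))

    star-on : (m : Fin h → Fin n) → Injective _≡_ _≡_ m → (∀ i → m i ∈ rich) →
              Σ (StVertex h k → Fin n) λ g → g centre ≡ v × IsStar G C h k g
    star-on m m-injective m∈rich = assemble (leaves-for m m∈rich)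
      where
      assemble : (Σ (Fin h → Fin k → Fin n) λ ℓ → (∀ {i j i′ j′} → ℓ i j ≡ ℓ i′ j′ → i ≡ i′ × j ≡ j′) ×
                   (∀ i j → ℓ i j ∈ candidates (m i) × ℓ i j ∉ v ∷ map m (allFin h))) →
                 Σ (StVertex h k → Fin n) λ g → g centre ≡ v × IsStar G C h k g
      assemble (ℓ , ℓ-injective , ℓ∈) = starMap v m ℓ , refl , record
        { injective = starMap-injective (λ i → rich⇒≢v (m∈rich i)) m-injective ℓ-injective (λ i j → proj₂ (ℓ∈ i j))
        ; edge      = λ i j → candidate⇒HasEdge (proj₁ (ℓ∈ i j))
        ; leaf-out  = λ i j → ind≡0⇒∉ (proj₂ (proj₁ (candidate⇒spoke (proj₁ (ℓ∈ i j)))))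
        }

    star : n * (order + h) ≤ degree G v → Σ (StVertex h k → Fin n) λ g → g centre ≡ v × IsStar G C h k g
    star deg≥ = star-on (proj₁ mids) (proj₁ (proj₂ mids)) (λ i → proj₁ (proj₂ (proj₂ mids) i))
      where
      mids : Σ (Fin h → Fin n) λ m → Injective _≡_ _≡_ m × (∀ i → m i ∈ rich × m i ∉ [])
      mids = distinct-representatives _≟_ [] (λ _ → rich) (λ _ → Unique.filter⁺ rich? (Unique.allFin⁺ n)) (λ _ → length-rich deg≥)

  IsStar-covered : ∀ {G : ThreeGraph n} {C h k g} → IsStar G C h k g → Fin h → Fin k →
                   ∀ w → ∃ λ e → e ∈ edges G × InTriple (g w) e
  IsStar-covered star i₀ j₀ centre with _ , _ , _ , e , e∈ , c∈ , _ , _ ← IsStar.edge star i₀ j₀ = e , e∈ , c∈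
  IsStar-covered star i₀ j₀ (mid i) with _ , _ , _ , e , e∈ , _ , m∈ , _ ← IsStar.edge star i j₀ = e , e∈ , m∈
  IsStar-covered star i₀ j₀ (leaf i j) with _ , _ , _ , e , e∈ , _ , _ , l∈ ← IsStar.edge star i j = e , e∈ , l∈

module _ {h k : ℕ} where

  allStVertices : List (StVertex h k)
  allStVertices = centre ∷ map mid (allFin h) ++ concat (map (λ i → map (leaf i) (allFin k)) (allFin h))

  ∈-allStVertices : ∀ w → w ∈ allStVertices
  ∈-allStVertices centre     = here refl
  ∈-allStVertices (mid i)    = there (∈-++⁺ˡ (∈-map⁺ mid (∈-allFin i)))
  ∈-allStVertices (leaf i j) = there (∈-++⁺ʳ (map mid (allFin h))
    (∈-concat⁺′ (∈-map⁺ (leaf i) (∈-allFin j)) (∈-map⁺ (λ i → map (leaf i) (allFin k)) (∈-allFin i))))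

  ∑-allStVertices-≤ : ∀ (f : StVertex h k → ℕ) (A B : ℕ) → f centre ≤ A → (∀ i → f (mid i) ≤ A) →
                      (∀ i j → f (leaf i j) ≤ B) → ∑ allStVertices f ≤ A + (h * A + h * (k * B))
  ∑-allStVertices-≤ f A B centre≤ mid≤ leaf≤ = +-mono-≤ centre≤ (≤-trans
    (≤-reflexive (∑-++ (map mid (allFin h)) _ f))
    (+-mono-≤ (≤-trans (≤-reflexive (∑-map mid (allFin h) f)) (∑-allFin-≤ _ A mid≤))
              (≤-trans (≤-reflexive (trans (∑-concat (map (λ i → map (leaf i) (allFin k)) (allFin h)) f) (∑-map (λ i → map (leaf i) (allFin k)) (allFin h) (λ xs → ∑ xs f))))
                       (∑-allFin-≤ _ (k * B) λ i → ≤-trans (≤-reflexive (∑-map (leaf i) (allFin k) f)) (∑-allFin-≤ _ B (leaf≤ i))))))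

module _ {n h k : ℕ} where

  starVertices : (StVertex h k → Fin n) → List (Fin n)
  starVertices g = map g allStVertices

  ∈-starVertices⁺ : ∀ g w → g w ∈ starVertices g
  ∈-starVertices⁺ g w = ∈-map⁺ g (∈-allStVertices w)

  ∈-starVertices⁻ : ∀ g {z} → z ∈ starVertices g → ∃ λ w → z ≡ g w
  ∈-starVertices⁻ g z∈ = let (w , _ , z≡gw) = ∈-map⁻ g z∈ in w , z≡gw

  ∑-starVertices-≤ : ∀ (g : StVertex h k → Fin n) (f : Fin n → ℕ) (A B : ℕ) → f (g centre) ≤ A →
                     (∀ i → f (g (mid i)) ≤ A) → (∀ i j → f (g (leaf i j)) ≤ B) →
                     ∑ (starVertices g) f ≤ A + (h * A + h * (k * B))
  ∑-starVertices-≤ g f A B centre≤ mid≤ leaf≤ =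
    ≤-trans (≤-reflexive (∑-map g allStVertices f)) (∑-allStVertices-≤ (λ w → f (g w)) A B centre≤ mid≤ leaf≤)

module Greedy {n : ℕ} (H : ThreeGraph n) (C : Subset n) (m h k : ℕ) (Inv : ℕ → List (Fin n) → Set) where

  Extension : ℕ → List (Fin n) → Set
  Extension j U = Σ (StVertex h k → Fin n) λ g → IsStar H C h k g × (∀ w → g w ∉ U) × Inv (suc j) (U ++ starVertices g)

  Step : Set
  Step = ∀ j → j < m → ∀ U → Inv j U → Extension j U

  record Stars (j : ℕ) : Set where
    field
      used      : List (Fin n)
      invariant : Inv j used
      copy      : Fin j × StVertex h k → Fin n
      injective : Injective _≡_ _≡_ copy
      edge      : ∀ c i l → HasEdge H (copy (c , centre)) (copy (c , mid i)) (copy (c , leaf i l))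
      leaf-out  : ∀ c i l → copy (c , leaf i l) Subset.∉ C
      copy-used : ∀ c w → copy (c , w) ∈ used

  no-stars : Inv 0 [] → Stars 0
  no-stars inv₀ = record
    { used = [] ; invariant = inv₀ ; copy = λ { (() , _) } ; injective = λ { {() , _} }
    ; edge = λ () ; leaf-out = λ () ; copy-used = λ () }

  add-star : ∀ {j} (S : Stars j) → Extension j (Stars.used S) → Stars (suc j)
  add-star S (g , star , g-fresh , inv′) = record
    { used = used ++ starVertices g ; invariant = inv′ ; copy = copy′ ; injective = injective′
    ; edge = edge′ ; leaf-out = leaf-out′ ; copy-used = copy-used′ }
    where
    open Stars S
    open IsStar star renaming (injective to g-injective; edge to g-edge; leaf-out to g-leaf)
    copy′ : Fin (suc _) × StVertex h k → Fin n
    copy′ (zero  , w) = g w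
    copy′ (suc c , w) = copy (c , w)
    injective′ : Injective _≡_ _≡_ copy′
    injective′ {zero  , w} {zero   , w′} eq = cong (zero ,_) (g-injective eq)
    injective′ {zero  , w} {suc c′ , w′} eq = ⊥-elim (g-fresh w (subst (_∈ used) (sym eq) (copy-used c′ w′)))
    injective′ {suc c , w} {zero   , w′} eq = ⊥-elim (g-fresh w′ (subst (_∈ used) eq (copy-used c w)))
    injective′ {suc c , w} {suc c′ , w′} eq = cong (λ { (c , w) → suc c , w }) (injective eq)
    edge′ : ∀ c i l → HasEdge H (copy′ (c , centre)) (copy′ (c , mid i)) (copy′ (c , leaf i l))
    edge′ zero    = g-edge
    edge′ (suc c) = edge c
    leaf-out′ : ∀ c i l → copy′ (c , leaf i l) Subset.∉ C
    leaf-out′ zero    = g-leaf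
    leaf-out′ (suc c) = leaf-out c
    copy-used′ : ∀ c w → copy′ (c , w) ∈ used ++ starVertices g
    copy-used′ zero    w = ∈-++⁺ʳ used (∈-starVertices⁺ g w)
    copy-used′ (suc c) w = ∈-++⁺ˡ (copy-used c w)

  stars : Inv 0 [] → Step → ∀ j → j ≤ m → Stars j
  stars inv₀ step zero    _      = no-stars inv₀
  stars inv₀ step (suc j) j<m = add-star S (step j j<m (Stars.used S) (Stars.invariant S))
    where
    S : Stars j
    S = stars inv₀ step j (≤-trans (n≤1+n j) j<m)

  disjointStars : Inv 0 [] → Step → DisjointStars H C m h k
  disjointStars inv₀ step = let open Stars (stars inv₀ step m (≤-reflexive refl)) in copy , injective , edge , leaf-out

-- Packing stars greedily

-- The quantities of the greedy argument for D stars St₃(D,k), where a = ∣ C ∣: K is the order of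
-- St₃(D,k) and T the degree that guarantees a star (StarAt.length-rich); Pn and P bound the sums
-- of n and of cost over one star; ΔA and ΔB are the heaviness thresholds in and outside C, chosen
-- so that a heavy centre keeps degree T after each deletion step; Lc bounds the degree sum of a
-- star on light vertices.
module Budget (n D k a : ℕ) where

  K T Pn P ΔA ΔB Lc edgeBudget : ℕ
  K  = 1 + D + D * k
  T  = n * (K + D)
  Pn = n + (D * n + D * (k * n))
  P  = n + (D * n + D * (k * a))
  ΔA = T + (D * Pn + D * n)
  ΔB = T + (D * P + D * n)
  Lc = (ΔA + ΔB) + (D * (ΔA + ΔB) + D * (k * ΔB))
  edgeBudget = a * T + D * Lc + D * (n * n)

module _ {n : ℕ} where

  ∉⇒lookup≡false : ∀ {C : Subset n} {x} → x Subset.∉ C → lookup C x ≡ false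
  ∉⇒lookup≡false {C} {x} x∉C with lookup C x in eq
  ... | true  = ⊥-elim (x∉C (lookup⇒[]= x C eq))
  ... | false = refl

  ind-false : ∀ (C : Subset n) x → lookup C x ≡ false → ind C x ≡ 0
  ind-false C x eq = cong (λ b → if b then 1 else 0) eq

module ManyStars {n : ℕ} (H : ThreeGraph n) (C : Subset n) (one : OneVertexIn H C)
                 (D k : ℕ) (i₀ : Fin D) (j₀ : Fin k) where

  a : ℕ
  a = ∣ C ∣

  open Budget n D k a

  threshold : Fin n → ℕ
  threshold z = if lookup C z then ΔA else ΔB

  cost : Fin n → ℕ
  cost z = if lookup C z then n else a

  cost-≤ : ∀ z → cost z ≤ n
  cost-≤ z with lookup C z
  ... | true  = ≤-refl
  ... | false = ∣p∣≤n C

  star-avoiding : (X : List (Fin n)) (v : Fin n) → T ≤ degree (H ∖ X) v →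
    Σ (StVertex D k → Fin n) λ g → g centre ≡ v × IsStar H C D k g × (∀ w → g w ∉ X)
  star-avoiding X v deg≥ = lift (StarAt.star (H ∖ X) C (OneVertexIn-∖ H C X one) D k v deg≥)
    where
    lift : (Σ (StVertex D k → Fin n) λ g → g centre ≡ v × IsStar (H ∖ X) C D k g) →
           Σ (StVertex D k → Fin n) λ g → g centre ≡ v × IsStar H C D k g × (∀ w → g w ∉ X)
    lift (g , g-centre , star) =
      g , g-centre ,
      record { injective = injective ; edge = λ i j → HasEdge-mono {G = H ∖ X} {G′ = H} (∖-⊆ H X) (edge i j) ; leaf-out = leaf-out } ,
      λ w → let (e , e∈ , w∈) = IsStar-covered star i₀ j₀ w in ∖-avoids H X e∈ w∈
      where open IsStar star

  heavy? : ∀ z → Dec (threshold z ≤ degree H z)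
  heavy? z = threshold z ≤? degree H z

  heavy : List (Fin n)
  heavy = filter heavy? (allFin n)

  threshold-≤ : ∀ z → threshold z ≤ ΔA + ΔB
  threshold-≤ z with lookup C z
  ... | true  = m≤m+n ΔA ΔB
  ... | false = m≤n+m ΔB ΔA

  threshold-out : ∀ {z} → z Subset.∉ C → threshold z ≡ ΔB
  threshold-out z∉C = cong (λ b → if b then ΔA else ΔB) (∉⇒lookup≡false z∉C)

  cost-out : ∀ {z} → z Subset.∉ C → cost z ≡ a
  cost-out z∉C = cong (λ b → if b then n else a) (∉⇒lookup≡false z∉C)

  ψ : Fin n → Fin n → ℕ
  ψ v z = if lookup C v then n else cost z

  ψ-≤ : ∀ v z → ψ v z ≤ n
  ψ-≤ v z with lookup C v
  ... | true  = ≤-refl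
  ... | false = cost-≤ z

  codegree-≤-ψ : ∀ {v z} → v ≢ z → codegree H v z ≤ ψ v z
  codegree-≤-ψ {v} {z} v≢z with lookup C v in v-in
  ... | true = codegree-≤ H v≢z
  ... | false with lookup C z in z-in
  ...   | true  = codegree-≤ H v≢z
  ...   | false = codegree-≤-∣C∣ H C one v≢z (ind-false C v v-in) (ind-false C z z-in)

  Pψ : Fin n → ℕ
  Pψ v = if lookup C v then Pn else P

  threshold-≡ : ∀ v → threshold v ≡ T + (D * Pψ v + D * n)
  threshold-≡ v with lookup C v
  ... | true  = refl
  ... | false = refl

  ∑-++-≤ : ∀ (U V : List (Fin n)) (f : Fin n → ℕ) {j B} → ∑ U f ≤ j * B → ∑ V f ≤ B → ∑ (U ++ V) f ≤ suc j * B
  ∑-++-≤ U V f {j} {B} U≤ V≤ = ≤-trans (≤-reflexive (∑-++ U V f)) (≤-trans (+-mono-≤ U≤ V≤) (≤-reflexive (+-comm (j * B) B)))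

  module Heavy (D≤heavy : D ≤ length heavy) where

    centres : Σ (Fin D → Fin n) λ s → Injective _≡_ _≡_ s × (∀ i → s i ∈ heavy × s i ∉ [])
    centres = distinct-representatives _≟_ [] (λ _ → heavy) (λ _ → Unique.filter⁺ heavy? (Unique.allFin⁺ n)) (λ _ → D≤heavy)

    s : Fin D → Fin n
    s = proj₁ centres

    s-heavy : ∀ i → threshold (s i) ≤ degree H (s i)
    s-heavy i = proj₂ (∈-filter⁻ heavy? {xs = allFin n} (proj₁ (proj₂ (proj₂ centres) i)))

    Inv : ℕ → List (Fin n) → Set
    Inv j U = ∑ U (λ _ → n) ≤ j * Pn × ∑ U cost ≤ j * P × (∀ i → j ≤ toℕ i → s i ∉ U)

    open Greedy H C D D k Inv using (Extension; disjointStars)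

    ∑-ψ-≤ : ∀ {j} U → Inv j U → ∀ v → ∑ U (ψ v) ≤ j * Pψ v
    ∑-ψ-≤ U (∑n≤ , ∑cost≤ , _) v with lookup C v
    ... | true  = ∑n≤
    ... | false = ∑cost≤

    module Step (j : ℕ) (j<D : j < D) (U : List (Fin n)) (inv : Inv j U) where

      ι : Fin D
      ι = fromℕ< j<D

      v : Fin n
      v = s ι

      -- The centres of the later stars are deleted too, so that they survive this step.
      others : List (Fin n)
      others = filter (λ z → ¬? (z ≟ v)) (map s (allFin D))

      X : List (Fin n)
      X = U ++ others

      v∉U : v ∉ U
      v∉U = proj₂ (proj₂ inv) ι (≤-reflexive (sym (toℕ-fromℕ< j<D)))

      X-≢v : ∀ {z} → z ∈ X → v ≢ z
      X-≢v {z} z∈X = [ (λ z∈U v≡z → v∉U (subst (_∈ U) (sym v≡z) z∈U))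
                     , (λ z∈others → ≢-sym (proj₂ (∈-filter⁻ (λ z → ¬? (z ≟ v)) {xs = map s (allFin D)} z∈others))) ]′
                     (∈-++⁻ U z∈X)

      length-others : length others ≤ D
      length-others = ≤-trans (length-filter _ (map s (allFin D))) (≤-reflexive (trans (length-map s (allFin D)) (length-allFin D)))

      loss-≤ : ∑[ z ∈ X ] codegree H v z ≤ D * Pψ v + D * n
      loss-≤ = ≤-trans (∑-mono X λ z∈X → codegree-≤-ψ (X-≢v z∈X)) (≤-trans (≤-reflexive (∑-++ U others (ψ v)))
        (+-mono-≤ (≤-trans (∑-ψ-≤ U inv v) (*-monoˡ-≤ (Pψ v) (<⇒≤ j<D)))
                  (≤-trans (∑-≤-const others n (λ {z} _ → ψ-≤ v z)) (*-monoˡ-≤ n length-others))))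

      degree-≥ : T ≤ degree (H ∖ X) v
      degree-≥ = +-cancelʳ-≤ (D * Pψ v + D * n) T (degree (H ∖ X) v) (begin
        T + (D * Pψ v + D * n)                      ≡⟨ sym (threshold-≡ v) ⟩
        threshold v                                 ≤⟨ s-heavy ι ⟩
        degree H v                                  ≤⟨ degree-∖ H X v ⟩
        degree (H ∖ X) v + ∑[ z ∈ X ] codegree H v z ≤⟨ +-monoʳ-≤ (degree (H ∖ X) v) loss-≤ ⟩
        degree (H ∖ X) v + (D * Pψ v + D * n)       ∎)
        where open ≤-Reasoning

      s-∉-star : ∀ {g : StVertex D k → Fin n} → (∀ w → g w ∉ X) → ∀ i → suc j ≤ toℕ i → s i ∉ starVertices g
      s-∉-star {g} g∉X i j<i si∈ with w , si≡gw ← ∈-starVertices⁻ g si∈ =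
        g∉X w (subst (_∈ X) si≡gw (∈-++⁺ʳ U (∈-filter⁺ (λ z → ¬? (z ≟ v)) (∈-map⁺ s (∈-allFin i)) si≢v)))
        where
        si≢v : s i ≢ v
        si≢v si≡v = <-irrefl (trans (sym (toℕ-fromℕ< j<D)) (cong toℕ (sym (proj₁ (proj₂ centres) si≡v)))) j<i

      extend : (Σ (StVertex D k → Fin n) λ g → g centre ≡ v × IsStar H C D k g × (∀ w → g w ∉ X)) → Extension j U
      extend (g , _ , star , g∉X) = g , star , (λ w gw∈U → g∉X w (∈-++⁺ˡ gw∈U)) ,
        ∑-++-≤ U (starVertices g) (λ _ → n) {j} (proj₁ inv) (∑-starVertices-≤ g (λ _ → n) n n ≤-refl (λ _ → ≤-refl) (λ _ _ → ≤-refl)) ,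
        ∑-++-≤ U (starVertices g) cost {j} (proj₁ (proj₂ inv))
          (∑-starVertices-≤ g cost n a (cost-≤ _) (λ _ → cost-≤ _) (λ i j → ≤-reflexive (cost-out (IsStar.leaf-out star i j)))) ,
        λ i j<i si∈ → [ proj₂ (proj₂ inv) i (≤-trans (n≤1+n j) j<i) , s-∉-star g∉X i j<i ]′ (∈-++⁻ U si∈)

      next : Extension j U
      next = extend (star-avoiding X v degree-≥)

    stars : DisjointStars H C D D k
    stars = disjointStars (z≤n , z≤n , λ _ _ ()) Step.next

  module Light (heavy<D : length heavy < D) (many-edges : edgeBudget < numEdges H) where

    Inv : ℕ → List (Fin n) → Set
    Inv j U = ∑ U (degree H) ≤ j * Lc

    open Greedy H C D D k Inv using (Extension; disjointStars)

    module Step (j : ℕ) (j<D : j < D) (U : List (Fin n)) (inv : Inv j U) where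

      X : List (Fin n)
      X = U ++ heavy

      loss-≤ : ∑ X (degree H) ≤ D * Lc + D * (n * n)
      loss-≤ = ≤-trans (≤-reflexive (∑-++ U heavy (degree H)))
        (+-mono-≤ (≤-trans inv (*-monoˡ-≤ Lc (<⇒≤ j<D)))
                  (≤-trans (∑-≤-const heavy (n * n) λ {z} _ → degree-≤ H z) (*-monoˡ-≤ (n * n) (<⇒≤ heavy<D))))

      many-left : a * T < numEdges (H ∖ X)
      many-left = +-cancelʳ-≤ (D * Lc + D * (n * n)) (suc (a * T)) (numEdges (H ∖ X)) (begin
        suc (a * T) + (D * Lc + D * (n * n)) ≡⟨ cong suc (sym (+-assoc (a * T) (D * Lc) (D * (n * n)))) ⟩
        suc (a * T + D * Lc + D * (n * n))   ≤⟨ many-edges ⟩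
        numEdges H                           ≤⟨ numEdges-∖ H X ⟩
        numEdges (H ∖ X) + ∑ X (degree H)    ≤⟨ +-monoʳ-≤ (numEdges (H ∖ X)) loss-≤ ⟩
        numEdges (H ∖ X) + (D * Lc + D * (n * n)) ∎)
        where open ≤-Reasoning

      light : ∀ {z} → z ∉ X → degree H z < threshold z
      light {z} z∉X = ≰⇒> λ heavy-z → z∉X (∈-++⁺ʳ U (∈-filter⁺ heavy? (∈-allFin z) heavy-z))

      extend : (Σ (StVertex D k → Fin n) λ g → IsStar H C D k g × (∀ w → g w ∉ X)) → Extension j U
      extend (g , star , g∉X) = g , star , (λ w gw∈U → g∉X w (∈-++⁺ˡ gw∈U)) ,
        ∑-++-≤ U (starVertices g) (degree H) {j} inv
          (∑-starVertices-≤ g (degree H) (ΔA + ΔB) ΔB (degree-≤-Δ centre) (λ i → degree-≤-Δ (mid i))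
            (λ i j → ≤-trans (<⇒≤ (light (g∉X (leaf i j)))) (≤-reflexive (threshold-out (IsStar.leaf-out star i j)))))
        where
        degree-≤-Δ : ∀ w → degree H (g w) ≤ ΔA + ΔB
        degree-≤-Δ w = ≤-trans (<⇒≤ (light (g∉X w))) (threshold-≤ (g w))

      centred : (∃ λ x → 1 ≤ ind C x × T ≤ degree (H ∖ X) x) →
                Σ (StVertex D k → Fin n) λ g → IsStar H C D k g × (∀ w → g w ∉ X)
      centred (x , _ , degree-≥) = let (g , _ , star , g∉X) = star-avoiding X x degree-≥ in g , star , g∉X

      next : Extension j U
      next = extend (centred (∃-vertex-in-of-degree (H ∖ X) C (OneVertexIn-∖ H C X one) T many-left))

    stars : DisjointStars H C D D k
    stars = disjointStars z≤n Step.next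

  disjointStars : edgeBudget < numEdges H → DisjointStars H C D D k
  disjointStars many-edges with D ≤? length heavy
  ... | yes D≤heavy = Heavy.stars D≤heavy
  ... | no  D≰heavy = Light.stars (≰⇒> D≰heavy) many-edges

-- Arithmetic

module BudgetBound (n D k a : ℕ) (1≤D : 1 ≤ D) (1≤k : 1 ≤ k) where

  open Budget n D k a

  1≤Dk : 1 ≤ D * k
  1≤Dk = *-mono-≤ 1≤D 1≤k
  D≤Dk : D ≤ D * k
  D≤Dk = ≤-trans (≤-reflexive (sym (*-identityʳ D))) (*-monoʳ-≤ D 1≤k)

  K+D-≤ : K + D ≤ 4 * (D * k)
  K+D-≤ = ≤-trans (+-mono-≤ (+-mono-≤ (+-mono-≤ 1≤Dk D≤Dk) ≤-refl) D≤Dk)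
         (≤-reflexive (solve 1 (λ x → x :+ x :+ x :+ x := con 4 :* x) refl (D * k)))

  T-≤ : T ≤ 4 * (D * k * n)
  T-≤ = ≤-trans (*-monoʳ-≤ n K+D-≤) (≤-reflexive (solve 3 (λ n D k → n :* (con 4 :* (D :* k)) := con 4 :* (D :* k :* n)) refl n D k))

  ΔA-≤ : ΔA ≤ 8 * (D * D * k * n)
  ΔA-≤ = ≤-trans (+-mono-≤ T-≤ (+-mono-≤ (*-monoʳ-≤ D ePn) eDn))
         (≤-trans (≤-reflexive (solve 3 (λ n D k → con 4 :* (D :* k :* n) :+ (D :* (con 3 :* (D :* k :* n)) :+ D :* (D :* k :* n)) := con 4 :* (D :* k :* n) :+ con 4 :* (D :* D :* k :* n)) refl n D k))
           (≤-trans (+-monoˡ-≤ _ (*-monoʳ-≤ 4 eDkn)) (≤-reflexive (solve 3 (λ n D k → con 4 :* (D :* D :* k :* n) :+ con 4 :* (D :* D :* k :* n) := con 8 :* (D :* D :* k :* n)) refl n D k))))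
    where
    n≤Dkn : n ≤ D * k * n
    n≤Dkn = ≤-trans (≤-reflexive (sym (*-identityˡ n))) (*-monoˡ-≤ n 1≤Dk)
    Dn≤Dkn : D * n ≤ D * k * n
    Dn≤Dkn = *-monoˡ-≤ n D≤Dk
    ePn : Pn ≤ 3 * (D * k * n)
    ePn = ≤-trans (+-mono-≤ n≤Dkn (+-mono-≤ Dn≤Dkn (≤-reflexive (sym (*-assoc D k n)))))
            (≤-reflexive (solve 1 (λ x → x :+ (x :+ x) := con 3 :* x) refl (D * k * n)))
    eDn : D * n ≤ D * (D * k * n)
    eDn = *-monoʳ-≤ D n≤Dkn
    eDkn : D * k * n ≤ D * D * k * n
    eDkn = ≤-trans (≤-reflexive (solve 3 (λ n D k → D :* k :* n := con 1 :* (D :* k :* n)) refl n D k))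
             (≤-trans (*-monoˡ-≤ (D * k * n) 1≤D) (≤-reflexive (solve 3 (λ n D k → D :* (D :* k :* n) := D :* D :* k :* n) refl n D k)))

  ΔB-≤ : ΔB ≤ 6 * (D * k * n) + D * D * n + D * D * k * a
  ΔB-≤ = ≤-trans (+-monoˡ-≤ (D * P + D * n) T-≤)
         (≤-trans (≤-reflexive (solve 4 (λ n D k a → con 4 :* (D :* k :* n) :+ (D :* (n :+ (D :* n :+ D :* (k :* a))) :+ D :* n)
                                        := con 4 :* (D :* k :* n) :+ con 2 :* (D :* n) :+ D :* D :* n :+ D :* D :* k :* a) refl n D k a))
           (≤-trans (+-monoˡ-≤ (D * D * k * a) (+-monoˡ-≤ (D * D * n) (+-monoʳ-≤ (4 * (D * k * n)) (*-monoʳ-≤ 2 (*-monoˡ-≤ n D≤Dk)))))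
             (≤-reflexive (solve 4 (λ n D k a → con 4 :* (D :* k :* n) :+ con 2 :* (D :* k :* n) :+ D :* D :* n :+ D :* D :* k :* a
                                    := con 6 :* (D :* k :* n) :+ D :* D :* n :+ D :* D :* k :* a) refl n D k a))))

  D*Lc-≤ : D * Lc ≤ 2 * (D * D) * (ΔA + ΔB) + D * D * k * ΔB
  D*Lc-≤ = ≤-trans (≤-reflexive (solve 4 (λ D k x y → D :* ((x :+ y) :+ (D :* (x :+ y) :+ D :* (k :* y)))
                                 := D :* (x :+ y) :+ D :* D :* (x :+ y) :+ D :* D :* k :* y) refl D k ΔA ΔB))
        (≤-trans (+-monoˡ-≤ (D * D * k * ΔB) (+-monoˡ-≤ (D * D * (ΔA + ΔB)) (*-monoˡ-≤ (ΔA + ΔB) D≤D*D)))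
          (≤-reflexive (solve 4 (λ D k x y → D :* D :* (x :+ y) :+ D :* D :* (x :+ y) :+ D :* D :* k :* y
                                 := con 2 :* (D :* D) :* (x :+ y) :+ D :* D :* k :* y) refl D k ΔA ΔB)))
    where
    D≤D*D : D ≤ D * D
    D≤D*D = ≤-trans (≤-reflexive (sym (*-identityʳ D))) (*-monoʳ-≤ D 1≤D)

  module _ {t : ℕ} (1≤t : 1 ≤ t) (t≤k : t ≤ k) (t*t≤2D : t * t ≤ 2 * D) (aD≤16nt : a * D ≤ 16 * (n * t)) (D³k≤n : D * D * D * k ≤ n) where
    Q : ℕ
    Q = D * D * D * k
    n³ : ℕ
    n³ = n * n * n
    Q*Q*n≤n³ : Q * Q * n ≤ n³
    Q*Q*n≤n³ = *-monoˡ-≤ n (*-mono-≤ D³k≤n D³k≤n)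
    Q*n*n≤n³ : Q * n * n ≤ n³
    Q*n*n≤n³ = *-monoˡ-≤ n (*-monoˡ-≤ n D³k≤n)
    t≤2D : t ≤ 2 * D
    t≤2D = ≤-trans (≤-trans (≤-reflexive (sym (*-identityʳ t))) (*-monoʳ-≤ t 1≤t)) t*t≤2D

    tD⁶kn tD⁵kn tD⁶n tD⁶ka tD⁵k²n tD⁶k²a tD³kna tD³n² : ℕ
    tD⁶kn = t * D * D * D * D * D * D * k * n
    tD⁵kn = t * D * D * D * D * D * k * n
    tD⁶n = t * D * D * D * D * D * D * n
    tD⁶ka = t * D * D * D * D * D * D * k * a
    tD⁵k²n = t * D * D * D * D * D * k * k * n
    tD⁶k²a = t * D * D * D * D * D * D * k * k * a
    tD³kna = t * D * D * D * k * n * a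
    tD³n² = t * D * D * D * n * n

    tD⁶kn-≤ : tD⁶kn ≤ n³
    tD⁶kn-≤ = ≤-trans (≤-reflexive (solve 4 (λ t D k n → t :* D :* D :* D :* D :* D :* D :* k :* n := t :* (D :* D :* D :* D :* D :* D :* k :* n)) refl t D k n))
         (≤-trans (*-monoˡ-≤ _ t≤k) (≤-trans (≤-reflexive (solve 3 (λ D k n → k :* (D :* D :* D :* D :* D :* D :* k :* n) := D :* D :* D :* k :* (D :* D :* D :* k) :* n) refl D k n)) Q*Q*n≤n³))

    tD⁵kn-≤ : tD⁵kn ≤ n³
    tD⁵kn-≤ = ≤-trans (≤-reflexive (sym (*-identityʳ tD⁵kn))) (≤-trans (*-monoʳ-≤ tD⁵kn 1≤D)
          (≤-trans (≤-reflexive (solve 4 (λ t D k n → t :* D :* D :* D :* D :* D :* k :* n :* D := t :* D :* D :* D :* D :* D :* D :* k :* n) refl t D k n)) tD⁶kn-≤))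

    tD⁶n-≤ : tD⁶n ≤ n³
    tD⁶n-≤ = ≤-trans (≤-reflexive (sym (*-identityʳ tD⁶n))) (≤-trans (*-monoʳ-≤ tD⁶n 1≤k)
          (≤-trans (≤-reflexive (solve 4 (λ t D k n → t :* D :* D :* D :* D :* D :* D :* n :* k := t :* D :* D :* D :* D :* D :* D :* k :* n) refl t D k n)) tD⁶kn-≤))

    taD-≤ : ∀ X → t * X * (a * D) ≤ 32 * (D * X * n)
    taD-≤ X = ≤-trans (*-monoʳ-≤ (t * X) aD≤16nt)
            (≤-trans (≤-reflexive (solve 4 (λ t X n D → t :* X :* (con 16 :* (n :* t)) := con 16 :* (t :* t) :* (X :* n)) refl t X n D))
            (≤-trans (*-monoˡ-≤ (X * n) (*-monoʳ-≤ 16 t*t≤2D))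
            (≤-reflexive (solve 3 (λ D X n → con 16 :* (con 2 :* D) :* (X :* n) := con 32 :* (D :* X :* n)) refl D X n))))

    tD⁶ka-≤ : tD⁶ka ≤ 32 * n³
    tD⁶ka-≤ = ≤-trans (≤-reflexive (solve 4 (λ t D k a → t :* D :* D :* D :* D :* D :* D :* k :* a := t :* (D :* D :* D :* D :* D :* k) :* (a :* D)) refl t D k a))
         (≤-trans (taD-≤ (D * D * D * D * D * k))
         (*-monoʳ-≤ 32 (≤-trans (≤-reflexive (sym (*-identityʳ (D * (D * D * D * D * D * k) * n)))) (≤-trans (*-monoʳ-≤ (D * (D * D * D * D * D * k) * n) 1≤k)
            (≤-trans (≤-reflexive (solve 3 (λ D k n → D :* (D :* D :* D :* D :* D :* k) :* n :* k := D :* D :* D :* k :* (D :* D :* D :* k) :* n) refl D k n)) Q*Q*n≤n³)))))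

    tD⁵k²n-≤ : tD⁵k²n ≤ 2 * n³
    tD⁵k²n-≤ = ≤-trans (≤-reflexive (solve 4 (λ t D k n → t :* D :* D :* D :* D :* D :* k :* k :* n := t :* (D :* D :* D :* D :* D :* k :* k :* n)) refl t D k n))
         (≤-trans (*-monoˡ-≤ _ t≤2D) (≤-trans (≤-reflexive (solve 3 (λ D k n → con 2 :* D :* (D :* D :* D :* D :* D :* k :* k :* n) := con 2 :* (D :* D :* D :* k :* (D :* D :* D :* k) :* n)) refl D k n))
         (*-monoʳ-≤ 2 Q*Q*n≤n³)))

    tD⁶k²a-≤ : tD⁶k²a ≤ 32 * n³
    tD⁶k²a-≤ = ≤-trans (≤-reflexive (solve 4 (λ t D k a → t :* D :* D :* D :* D :* D :* D :* k :* k :* a := t :* (D :* D :* D :* D :* D :* k :* k) :* (a :* D)) refl t D k a))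
         (≤-trans (taD-≤ (D * D * D * D * D * k * k))
         (*-monoʳ-≤ 32 (≤-trans (≤-reflexive (solve 3 (λ D k n → D :* (D :* D :* D :* D :* D :* k :* k) :* n := D :* D :* D :* k :* (D :* D :* D :* k) :* n) refl D k n)) Q*Q*n≤n³)))

    tD³kna-≤ : tD³kna ≤ 32 * n³
    tD³kna-≤ = ≤-trans (≤-reflexive (solve 5 (λ t D k n a → t :* D :* D :* D :* k :* n :* a := t :* (D :* D :* k :* n) :* (a :* D)) refl t D k n a))
         (≤-trans (taD-≤ (D * D * k * n))
         (*-monoʳ-≤ 32 (≤-trans (≤-reflexive (solve 3 (λ D k n → D :* (D :* D :* k :* n) :* n := D :* D :* D :* k :* n :* n) refl D k n)) Q*n*n≤n³)))

    tD³n²-≤ : tD³n² ≤ n³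
    tD³n²-≤ = ≤-trans (≤-reflexive (solve 3 (λ t D n → t :* D :* D :* D :* n :* n := t :* (D :* D :* D :* n :* n)) refl t D n))
         (≤-trans (*-monoˡ-≤ _ t≤k) (≤-trans (≤-reflexive (solve 3 (λ D k n → k :* (D :* D :* D :* n :* n) := D :* D :* D :* k :* n :* n) refl D k n)) Q*n*n≤n³))

    -- The edge hypothesis gives e * W ≥ 1073 n³ (cn³≤eW).
    W : ℕ
    W = 4 * t * (D * D)

    ΔB-bound : ℕ
    ΔB-bound = 6 * (D * k * n) + D * D * n + D * D * k * a

    W*edgeBudget-≤-polynomial : W * edgeBudget ≤ W * (a * (4 * (D * k * n))) + W * (2 * (D * D) * (8 * (D * D * k * n) + ΔB-bound) + D * D * k * ΔB-bound) + W * (D * (n * n))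
    W*edgeBudget-≤-polynomial = ≤-trans (≤-reflexive (solve 6 (λ W a T D L m → W :* (a :* T :+ D :* L :+ m) := W :* (a :* T) :+ W :* (D :* L) :+ W :* m) refl W a T D Lc (D * (n * n))))
            (+-monoˡ-≤ _ (+-mono-≤ (*-monoʳ-≤ W (*-monoʳ-≤ a T-≤))
               (*-monoʳ-≤ W (≤-trans D*Lc-≤ (+-mono-≤ (*-monoʳ-≤ (2 * (D * D)) (+-mono-≤ ΔA-≤ ΔB-≤)) (*-monoʳ-≤ (D * D * k) ΔB-≤))))))

    polynomial-≡-monomials : W * (a * (4 * (D * k * n))) + W * (2 * (D * D) * (8 * (D * D * k * n) + ΔB-bound) + D * D * k * ΔB-bound) + W * (D * (n * n))
            ≡ 16 * tD³kna + 64 * tD⁶kn + 48 * tD⁵kn + 8 * tD⁶n + 8 * tD⁶ka + 24 * tD⁵k²n + 4 * tD⁶kn + 4 * tD⁶k²a + 4 * tD³n²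
    polynomial-≡-monomials = solve 5 (λ t D k n a →
        (con 4 :* t :* (D :* D)) :* (a :* (con 4 :* (D :* k :* n)))
        :+ (con 4 :* t :* (D :* D)) :* (con 2 :* (D :* D) :* (con 8 :* (D :* D :* k :* n) :+ (con 6 :* (D :* k :* n) :+ D :* D :* n :+ D :* D :* k :* a))
                                       :+ D :* D :* k :* (con 6 :* (D :* k :* n) :+ D :* D :* n :+ D :* D :* k :* a))
        :+ (con 4 :* t :* (D :* D)) :* (D :* (n :* n))
      := con 16 :* (t :* D :* D :* D :* k :* n :* a) :+ con 64 :* (t :* D :* D :* D :* D :* D :* D :* k :* n)
         :+ con 48 :* (t :* D :* D :* D :* D :* D :* k :* n) :+ con 8 :* (t :* D :* D :* D :* D :* D :* D :* n)
         :+ con 8 :* (t :* D :* D :* D :* D :* D :* D :* k :* a) :+ con 24 :* (t :* D :* D :* D :* D :* D :* k :* k :* n)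
         :+ con 4 :* (t :* D :* D :* D :* D :* D :* D :* k :* n) :+ con 4 :* (t :* D :* D :* D :* D :* D :* D :* k :* k :* a)
         :+ con 4 :* (t :* D :* D :* D :* n :* n)) refl t D k n a

    monomials-≤ : 16 * tD³kna + 64 * tD⁶kn + 48 * tD⁵kn + 8 * tD⁶n + 8 * tD⁶ka + 24 * tD⁵k²n + 4 * tD⁶kn + 4 * tD⁶k²a + 4 * tD³n² ≤ 1072 * n³
    monomials-≤ = ≤-trans (+-mono-≤ (+-mono-≤ (+-mono-≤ (+-mono-≤ (+-mono-≤ (+-mono-≤ (+-mono-≤ (+-mono-≤
               (*-monoʳ-≤ 16 tD³kna-≤) (*-monoʳ-≤ 64 tD⁶kn-≤)) (*-monoʳ-≤ 48 tD⁵kn-≤)) (*-monoʳ-≤ 8 tD⁶n-≤)) (*-monoʳ-≤ 8 tD⁶ka-≤))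
               (*-monoʳ-≤ 24 tD⁵k²n-≤)) (*-monoʳ-≤ 4 tD⁶kn-≤)) (*-monoʳ-≤ 4 tD⁶k²a-≤)) (*-monoʳ-≤ 4 tD³n²-≤))
            (≤-reflexive (solve 1 (λ x → con 16 :* (con 32 :* x) :+ con 64 :* x :+ con 48 :* x :+ con 8 :* x :+ con 8 :* (con 32 :* x)
               :+ con 24 :* (con 2 :* x) :+ con 4 :* x :+ con 4 :* (con 32 :* x) :+ con 4 :* x := con 1072 :* x) refl n³))

    W*edgeBudget-≤ : W * edgeBudget ≤ 1072 * n³
    W*edgeBudget-≤ = ≤-trans W*edgeBudget-≤-polynomial (≤-trans (≤-reflexive polynomial-≡-monomials) monomials-≤)

^-cancelʳ-≤ : ∀ m .{{_ : NonZero m}} {x y} → x ^ m ≤ y ^ m → x ≤ y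
^-cancelʳ-≤ m {x} {y} xᵐ≤yᵐ with x ≤? y
... | yes x≤y = x≤y
... | no  x≰y = ⊥-elim (<⇒≱ (^-monoˡ-< m (≰⇒> x≰y)) xᵐ≤yᵐ)

1≤D : ∀ {n k} D → k ≤ n → n < (D + 1) ^ 3 * k → 1 ≤ D
1≤D {k = k} zero    k≤n n<k = ⊥-elim (<⇒≱ (≤-trans n<k (≤-reflexive (+-identityʳ k))) k≤n)
1≤D         (suc _) _   _   = s≤s z≤n

module _ {n k : ℕ} (D : ℕ) where

  D³k≤n : D ^ 3 * k ≤ n → D * D * D * k ≤ n
  D³k≤n = ≤-trans (≤-reflexive (solve 2 (λ D k → D :* D :* D :* k := D :^ 3 :* k) refl D k))

  n≤8D³k : 1 ≤ D → n < (D + 1) ^ 3 * k → n ≤ 8 * (D * D * D * k)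
  n≤8D³k 1≤D n< = ≤-trans (<⇒≤ n<) (≤-trans (*-monoˡ-≤ k (^-monoˡ-≤ 3 D+1≤2D))
    (≤-reflexive (solve 2 (λ D k → (con 2 :* D) :^ 3 :* k := con 8 :* (D :* D :* D :* k)) refl D k)))
    where
    D+1≤2D : D + 1 ≤ 2 * D
    D+1≤2D = ≤-trans (+-monoʳ-≤ D 1≤D) (≤-reflexive (solve 1 (λ D → D :+ D := con 2 :* D) refl D))

  t²≤2D : ∀ {t} .{{_ : NonZero k}} → t ^ 6 * k ≤ n → n ≤ 8 * (D * D * D * k) → t * t ≤ 2 * D
  t²≤2D {t} t⁶k≤n n≤ = ^-cancelʳ-≤ 3 (*-cancelʳ-≤ ((t * t) ^ 3) ((2 * D) ^ 3) k
    (≤-trans (≤-reflexive (solve 2 (λ t k → (t :* t) :^ 3 :* k := t :^ 6 :* k) refl t k))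
    (≤-trans t⁶k≤n (≤-trans n≤ (≤-reflexive (solve 2 (λ D k → con 8 :* (D :* D :* D :* k) := (con 2 :* D) :^ 3 :* k) refl D k))))))

  aD≤16nt : ∀ {t a} .{{_ : NonZero n}} → a ^ 3 * n ≤ 4096 * n ^ 3 * t ^ 3 * k → D * D * D * k ≤ n → a * D ≤ 16 * (n * t)
  aD≤16nt {t} {a} small D³k≤n = ^-cancelʳ-≤ 3 (*-cancelʳ-≤ ((a * D) ^ 3) ((16 * (n * t)) ^ 3) n
    (≤-trans (≤-reflexive (solve 3 (λ a D n → (a :* D) :^ 3 :* n := (a :^ 3 :* n) :* (D :* D :* D)) refl a D n))
    (≤-trans (*-monoˡ-≤ (D * D * D) small)
    (≤-trans (≤-reflexive (solve 4 (λ n t k D → con 4096 :* n :^ 3 :* t :^ 3 :* k :* (D :* D :* D)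
                                             := con 4096 :* n :^ 3 :* t :^ 3 :* (D :* D :* D :* k)) refl n t k D))
    (≤-trans (*-monoʳ-≤ (4096 * n ^ 3 * t ^ 3) D³k≤n)
    (≤-reflexive (solve 2 (λ n t → con 4096 :* n :^ 3 :* t :^ 3 :* n := (con 16 :* (n :* t)) :^ 3 :* n) refl n t)))))))

  cn³≤eW : ∀ {c t e} .{{_ : NonZero k}} → c ^ 3 * n ^ 9 * k ^ 2 ≤ (e * t) ^ 3 * n ^ 2 → n ≤ 8 * (D * D * D * k) →
           c * (n * n * n) ≤ e * (4 * t * (D * D))
  cn³≤eW {c} {t} {e} many n≤ = ^-cancelʳ-≤ 3 (*-cancelʳ-≤ ((c * (n * n * n)) ^ 3) ((e * (4 * t * (D * D))) ^ 3) (k ^ 2)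
      {{>-nonZero (^-monoˡ-≤ 2 (>-nonZero⁻¹ k))}}
    (≤-trans (≤-reflexive (solve 3 (λ c n k → (c :* (n :* n :* n)) :^ 3 :* k :^ 2 := c :^ 3 :* n :^ 9 :* k :^ 2) refl c n k))
    (≤-trans many
    (≤-trans (*-monoʳ-≤ ((e * t) ^ 3) n²≤)
    (≤-reflexive (solve 4 (λ e t D k → (e :* t) :^ 3 :* (con 64 :* (D :* D :* D :* k) :* (D :* D :* D :* k))
                                     := (e :* (con 4 :* t :* (D :* D))) :^ 3 :* k :^ 2) refl e t D k))))))
    where
    n²≤ : n ^ 2 ≤ 64 * (D * D * D * k) * (D * D * D * k)
    n²≤ = ≤-trans (≤-reflexive (solve 1 (λ n → n :^ 2 := n :* n) refl n)) (≤-trans (*-mono-≤ n≤ n≤)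
            (≤-reflexive (solve 1 (λ x → con 8 :* x :* (con 8 :* x) := con 64 :* x :* x) refl (D * D * D * k))))

<-of-scaled : ∀ {W s e m} c → 1 ≤ m → W * s ≤ c * m → suc c * m ≤ e * W → s < e
<-of-scaled {W} {s} {e} {m} c 1≤m Ws≤ ≤eW = *-cancelˡ-< W s e (begin-strict
  W * s      ≤⟨ Ws≤ ⟩
  c * m      <⟨ m<n+m (c * m) 1≤m ⟩
  suc c * m  ≤⟨ ≤eW ⟩
  e * W      ≡⟨ *-comm e W ⟩
  W * e      ∎)
  where open ≤-Reasoning

stars-of-many-edges : (n k t : ℕ) → .{{NonZero n}} → .{{NonZero k}} → .{{NonZero t}} →
    t ≤ k → t ^ 6 * k ≤ n →
    (D : ℕ) → D ^ 3 * k ≤ n → n < (D + 1) ^ 3 * k →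
    (H : ThreeGraph n) →
    1073 ^ 3 * n ^ 9 * k ^ 2 ≤ (numEdges H * t) ^ 3 * n ^ 2 →
    (C₀ : Subset n) →
    ∣ C₀ ∣ ^ 3 * n ≤ 4096 * n ^ 3 * t ^ 3 * k →
    OneVertexIn H C₀ →
    DisjointStars H C₀ D D k
stars-of-many-edges n k t t≤k t⁶k≤n D D³k≤n′ n< H many C₀ C₀-small one =
  ManyStars.disjointStars H C₀ one D k (fromℕ< D-pos) (fromℕ< 1≤k)
    (<-of-scaled 1072 (*-mono-≤ (*-mono-≤ 1≤n 1≤n) 1≤n)
      (BudgetBound.W*edgeBudget-≤ n D k ∣ C₀ ∣ D-pos 1≤k (>-nonZero⁻¹ t) t≤k (t²≤2D D {t} t⁶k≤n n≤8Q) (aD≤16nt D {t} {∣ C₀ ∣} C₀-small Q≤n) Q≤n)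
      (cn³≤eW D {1073} {t} {numEdges H} many n≤8Q))
  where
  1≤n : 1 ≤ n
  1≤n = >-nonZero⁻¹ n
  1≤k : 1 ≤ k
  1≤k = >-nonZero⁻¹ k
  k≤n : k ≤ n
  k≤n = ≤-trans (≤-trans (≤-reflexive (sym (*-identityˡ k))) (*-monoˡ-≤ k (^-monoˡ-≤ 6 (>-nonZero⁻¹ t)))) t⁶k≤n
  D-pos : 1 ≤ D
  D-pos = 1≤D D k≤n n<
  Q≤n : D * D * D * k ≤ n
  Q≤n = D³k≤n D D³k≤n′
  n≤8Q : n ≤ 8 * (D * D * D * k)
  n≤8Q = n≤8D³k D D-pos n<

lemma5p4 : Σ ℕ λ C →
    (n k t : ℕ) → .{{NonZero n}} → .{{NonZero k}} → .{{NonZero t}} →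
    t ≤ k → t ^ 6 * k ≤ n →
    (D : ℕ) → D ^ 3 * k ≤ n → n < (D + 1) ^ 3 * k →
    (H : ThreeGraph n) →
    C ^ 3 * n ^ 9 * k ^ 2 ≤ (numEdges H * t) ^ 3 * n ^ 2 →
    (C₀ : Subset n) →
    ∣ C₀ ∣ ^ 3 * n ≤ 4096 * n ^ 3 * t ^ 3 * k →
    OneVertexIn H C₀ →
    DisjointStars H C₀ D D k
lemma5p4 = 1073 , stars-of-many-edges
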